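{- Let $p,q$ be complex numbers with $p\neq0$, $q\neq0$, $p^2-4q\neq0$, and let $(u_n),(v_n)$ be as in the context. Let $r,s,k$ be integers, $n$ a nonnegative integer (a positive integer for the second identity), and $z$ a complex number such that all denominators below are nonzero. Then \[ \begin{split} 2(p^2 -4q)^n\sum_{j = 0}^k u_{rj + s}^{2n} z^j =& \sum_{i = 0}^{2n} (-1)^i\binom {2n}iq^{si} \frac{q^{r(2n + ki)} v_{(rk + s)(2n - 2i)} z^{k + 2} - q^{ri(k + 1)} v_{(rk + r + s)(2n - 2i)} z^{k + 1} }{q^{2rn} z^2 - q^{ri} v_{r(2n - 2i)} z + 1}\\ &- \sum_{i = 0}^{2n} (-1)^i\binom {2n}iq^{si} \frac{q^{s(2n - 2i) + ri} v_{(r - s)(2n - 2i)} z - v_{s(2n - 2i)} }{q^{2rn} z^2 - q^{ri} v_{r(2n - 2i)} z + 1}\,, \end{split} \] \[ \begin{split} 2(p^2 -4q)^{n-1}\sum_{j = 0}^k u_{rj + s}^{2n - 1} z^j =& \sum_{i = 0}^{2n - 1} (-1)^i\binom {2n - 1}iq^{si} \frac{q^{r(2n - 1 + ki)} u_{(rk + s)(2n - 1 - 2i)} z^{k + 2} - q^{ri(k + 1)} u_{(rk + r + s)(2n - 1 - 2i)} z^{k + 1} }{q^{(2n - 1)r} z^2 - q^{ri} v_{r(2n - 1 - 2i)} z + 1}\\ &+ \sum_{i = 0}^{2n - 1} (-1)^i\binom {2n - 1}iq^{si} \frac{q^{s(2n - 1 - 2i) + ri} u_{(r - s)(2n - 1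 - 2i)} z + u_{s(2n - 1 - 2i)} }{q^{(2n - 1)r} z^2 - q^{ri} v_{r(2n - 1 - 2i)} z + 1}\,, \end{split} \] \[ \begin{split} 2\sum_{j = 0}^k v_{rj + s}^n z^j =& \sum_{i = 0}^n \binom niq^{si} \frac{q^{r(n + ki)} v_{(rk + s)(n - 2i)} z^{k + 2} - q^{ri(k + 1)} v_{(rk + r + s)(n - 2i)} z^{k + 1} }{q^{rn} z^2 - q^{ri} v_{r(n - 2i)} z + 1}\\ &- \sum_{i = 0}^n \binom niq^{si} \frac{q^{s(n - 2i) + ri} v_{(r - s)(n - 2i)} z - v_{s(n - 2i)} }{q^{rn} z^2 - q^{ri} v_{r(n - 2i)} z + 1}\,. \end{split} \]
   Context: For complex $p\neq0$, $q\neq0$, the Lucas sequences $(u_n)$ and $(v_n)$ are defined for all integers $n$ by $u_0=0,u_1=1$, $v_0=2,v_1=p$, and $x_n=px_{n-1}-qx_{n-2}$ (extended to negative indices by running the recurrence backwards). With $\alpha,\beta$ the distinct roots of $x^2-px+q$, one has $u_n=(\alpha^n-\beta^n)/(\alpha-\beta)$ and $v_n=\alpha^n+\beta^n$ for all integers $n$. -}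

module Defs where

open import Level using (Level; _⊔_) renaming (suc to lsuc)
open import Algebra.Bundles using (CommutativeRing)
open import Relation.Nullary using (¬_)
open import Data.Nat as ℕ using (ℕ; zero; suc)
open import Data.Integer as ℤ using (ℤ; +_; -[1+_])

-- The inverse is a total operation; its value
-- at 0 is unconstrained and never used for the statement (all inverted
-- quantities are assumed nonzero).
record Field (c ℓ : Level) : Set (lsuc (c ⊔ ℓ)) where
  field
    commutativeRing : CommutativeRing c ℓ
  open CommutativeRing commutativeRing public
  field
    _⁻¹      : Carrier → Carrier
    ⁻¹-cong  : ∀ {x y} → x ≈ y → x ⁻¹ ≈ y ⁻¹
    0≉1      : ¬ (0# ≈ 1#)
    inverseʳ : ∀ x → ¬ (x ≈ 0#) → x * (x ⁻¹) ≈ 1#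

module FieldOps {c ℓ : Level} (F : Field c ℓ) where
  open Field F hiding (zero)

  _÷_ : Carrier → Carrier → Carrier
  x ÷ y = x * (y ⁻¹)

  fromℕ : ℕ → Carrier
  fromℕ zero    = 0#
  fromℕ (suc n) = 1# + fromℕ n

  CharZero : Set ℓ
  CharZero = ∀ n → ¬ (fromℕ (suc n) ≈ 0#)

  _^ⁿ_ : Carrier → ℕ → Carrier
  x ^ⁿ zero  = 1#
  x ^ⁿ suc n = x * (x ^ⁿ n)

  _^ᶻ_ : Carrier → ℤ → Carrier
  x ^ᶻ (+ n)      = x ^ⁿ n
  x ^ᶻ (-[1+ n ]) = (x ⁻¹) ^ⁿ (suc n)

  Σ[0…_] : ℕ → (ℕ → Carrier) → Carrier
  Σ[0… zero ] f  = f zero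
  Σ[0… suc m ] f = Σ[0… m ] f + f (suc m)

  Σ[0…<_] : ℕ → (ℕ → Carrier) → Carrier
  Σ[0…< zero ] f  = 0#
  Σ[0…< suc m ] f = Σ[0…< m ] f + f m

  -- Σ_{j=0}^{k} f j for an integer k, with the standard convention
  -- Σ_{j=0}^{k} f j = - Σ_{j=k+1}^{-1} f j for k < 0 (so it is 0 for k = -1).
  Σᶻ[0…_] : ℤ → (ℤ → Carrier) → Carrier
  Σᶻ[0… + m ] f      = Σ[0… m ] (λ j → f (+ j))
  Σᶻ[0… -[1+ m ] ] f = - Σ[0…< m ] (λ t → f -[1+ t ])

  sgn : ℕ → Carrier
  sgn i = (- 1#) ^ⁿ i

-- Lucas sequences with parameters p, q in a field, defined for all integer
-- indices by x_n = p x_{n-1} - q x_{n-2}, run backwards for negative indices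
-- (x_{n-2} = (p x_{n-1} - x_n) / q).
module Lucas {c ℓ : Level} (F : Field c ℓ) (p q : Field.Carrier F) where
  open Field F hiding (zero)
  open FieldOps F

  fwd : Carrier → Carrier → ℕ → Carrier
  fwd a b zero          = a
  fwd a b (suc zero)    = b
  fwd a b (suc (suc n)) = p * fwd a b (suc n) - q * fwd a b n

  -- backward values bwd a b n = x_{-n}
  bwd : Carrier → Carrier → ℕ → Carrier
  bwd a b zero          = a
  bwd a b (suc zero)    = (p * a - b) ÷ q
  bwd a b (suc (suc n)) = (p * bwd a b (suc n) - bwd a b n) ÷ q

  seq : Carrier → Carrier → ℤ → Carrier
  seq a b (+ n)      = fwd a b n
  seq a b (-[1+ n ]) = bwd a b (suc n)

  u : ℤ → Carrier
  u = seq 0# 1#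

  v : ℤ → Carrier
  v = seq (1# + 1#) p

-- Adjoin √D to F and put α, β = (p ± √D)/2, the roots of x² - p x + q; they are units since
-- α β = q.  Both sides of v_m = α^m + β^m and √D u_m = α^m - β^m solve the recurrence and
-- agree at m = 0, 1, so these Binet formulas hold for all integers m; they give the addition
-- law g_{x+y} = g_x v_y - q^y g_{x-y} and the reflection law g_{-x} q^x = ±g_x for g = v, u.
-- Expanding (α^m ± β^m)^N binomially and pairing the k-th with the (N-k)-th term writes
-- 2 v_m^N, 2 D^n u_m^{2n} and 2 D^n u_m^{2n+1} as Σ_i a_i q^{mi} g_{m(N-2i)}.  By the
-- addition law, w_j = q^{(rj+s)i} g_{(rj+s)(N-2i)} satisfies
-- w_{j+1} = q^{ri} v_{r(N-2i)} w_j - q^{rN} w_{j-1}, so (q^{rN} z² - q^{ri} v_{r(N-2i)} z + 1)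
-- Σ_{j=0}^k w_j z^j telescopes to boundary terms at j = k and j = -1, and the reflection law
-- turns the latter into the second sum of each identity.

module Submission where

open import Level using (_⊔_)
open import Algebra.Bundles using (CommutativeRing; AbelianGroup)
open import Algebra.Construct.DirectProduct using (abelianGroup)
import Algebra.Solver.Ring
import Algebra.Solver.Ring.AlmostCommutativeRing as ACR
open import Data.Maybe using (Maybe; just; nothing)
open import Data.Nat as ℕ using (ℕ; zero; suc; _∸_)
import Data.Nat.Properties as ℕ
open import Data.Nat.Combinatorics using (_C_)
open import Data.Integer as ℤ using (ℤ; +_; -[1+_]; _⊖_)
import Data.Integer.Properties as ℤ
open import Data.Integer.Tactic.RingSolver using (solve-∀)
open import Data.Fin as Fin using (toℕ; inject₁)
open import Data.Fin.Properties using (toℕ<n; toℕ-inject₁; toℕ-fromℕ)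
open import Function using (_∘_)
open import Relation.Nullary using (¬_; yes; no)
open import Relation.Binary.PropositionalEquality as ≡ using (_≡_)
open import Defs

module IntegerCoefficientSolver {c ℓ} (R : CommutativeRing c ℓ) where
  open CommutativeRing R
  open import Algebra.Properties.Ring ring using (-‿involutive; -‿distribˡ-*; -‿distribʳ-*; -‿+-comm; -0#≈0#)
  open import Algebra.Properties.Semiring.Mult semiring using (_×_; ×-homo-+; ×1-homo-*)
  open import Relation.Binary.Reasoning.Setoid setoid

  fromℤ : ℤ → Carrier
  fromℤ (+ n)      = n × 1#
  fromℤ -[1+ n ]   = - (suc n × 1#)

  fromℤ-⊖ : ∀ m n → fromℤ (m ⊖ n) ≈ m × 1# - n × 1#
  fromℤ-⊖ m       zero    = sym (trans (+-congˡ -0#≈0#) (+-identityʳ _))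
  fromℤ-⊖ zero    (suc n) = sym (+-identityˡ _)
  fromℤ-⊖ (suc m) (suc n) = begin
    fromℤ (suc m ⊖ suc n)               ≡⟨ ≡.cong fromℤ (ℤ.[1+m]⊖[1+n]≡m⊖n m n) ⟩
    fromℤ (m ⊖ n)                       ≈⟨ fromℤ-⊖ m n ⟩
    m × 1# - n × 1#                     ≈⟨ shift (m × 1#) (n × 1#) ⟩
    (1# + m × 1#) - (1# + n × 1#)       ∎
    where
    shift : ∀ a b → a - b ≈ (1# + a) - (1# + b)
    shift a b = begin
      a - b                   ≈⟨ +-identityˡ _ ⟨
      0# + (a - b)            ≈⟨ +-congʳ (-‿inverseʳ 1#) ⟨
      (1# - 1#) + (a - b)     ≈⟨ +-assoc _ _ _ ⟩
      1# + (- 1# + (a - b))   ≈⟨ +-congˡ (+-assoc _ _ _) ⟨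
      1# + ((- 1# + a) - b)   ≈⟨ +-congˡ (+-congʳ (+-comm _ _)) ⟩
      1# + ((a - 1#) - b)     ≈⟨ +-congˡ (+-assoc _ _ _) ⟩
      1# + (a + (- 1# - b))   ≈⟨ +-assoc _ _ _ ⟨
      (1# + a) + (- 1# - b)   ≈⟨ +-congˡ (-‿+-comm 1# b) ⟩
      (1# + a) - (1# + b)     ∎

  fromℤ-homo-+ : ∀ a b → fromℤ (a ℤ.+ b) ≈ fromℤ a + fromℤ b
  fromℤ-homo-+ (+ m)    (+ n)    = ×-homo-+ 1# m n
  fromℤ-homo-+ (+ m)    -[1+ n ] = fromℤ-⊖ m (suc n)
  fromℤ-homo-+ -[1+ m ] (+ n)    = trans (fromℤ-⊖ n (suc m)) (+-comm _ _)
  fromℤ-homo-+ -[1+ m ] -[1+ n ] = begin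
    - (suc (suc (m ℕ.+ n)) × 1#)          ≡⟨ ≡.cong (λ t → - (t × 1#)) (ℕ.+-suc (suc m) n) ⟨
    - ((suc m ℕ.+ suc n) × 1#)            ≈⟨ -‿cong (×-homo-+ 1# (suc m) (suc n)) ⟩
    - (suc m × 1# + suc n × 1#)           ≈⟨ -‿+-comm _ _ ⟨
    - (suc m × 1#) - suc n × 1#           ∎

  fromℤ-homo-neg : ∀ a → fromℤ (ℤ.- a) ≈ - fromℤ a
  fromℤ-homo-neg (+ zero)  = sym -0#≈0#
  fromℤ-homo-neg (+ suc n) = refl
  fromℤ-homo-neg -[1+ n ]  = sym (-‿involutive _)

  fromℤ-homo-*⁺ : ∀ m b → fromℤ (+ m ℤ.* b) ≈ m × 1# * fromℤ b
  fromℤ-homo-*⁺ m (+ n)    = trans (reflexive (≡.cong fromℤ (≡.sym (ℤ.pos-* m n)))) (×1-homo-* m n)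
  fromℤ-homo-*⁺ m -[1+ n ] = begin
    fromℤ (+ m ℤ.* ℤ.- + suc n)          ≡⟨ ≡.cong fromℤ (ℤ.neg-distribʳ-* (+ m) (+ suc n)) ⟨
    fromℤ (ℤ.- (+ m ℤ.* + suc n))        ≈⟨ fromℤ-homo-neg (+ m ℤ.* + suc n) ⟩
    - fromℤ (+ m ℤ.* + suc n)            ≈⟨ -‿cong (fromℤ-homo-*⁺ m (+ suc n)) ⟩
    - (m × 1# * suc n × 1#)              ≈⟨ -‿distribʳ-* _ _ ⟩
    m × 1# * - (suc n × 1#)              ∎

  fromℤ-homo-* : ∀ a b → fromℤ (a ℤ.* b) ≈ fromℤ a * fromℤ b
  fromℤ-homo-* (+ m)    b = fromℤ-homo-*⁺ m b
  fromℤ-homo-* -[1+ m ] b = begin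
    fromℤ (ℤ.- + suc m ℤ.* b)            ≡⟨ ≡.cong fromℤ (ℤ.neg-distribˡ-* (+ suc m) b) ⟨
    fromℤ (ℤ.- (+ suc m ℤ.* b))          ≈⟨ fromℤ-homo-neg (+ suc m ℤ.* b) ⟩
    - fromℤ (+ suc m ℤ.* b)              ≈⟨ -‿cong (fromℤ-homo-*⁺ (suc m) b) ⟩
    - (suc m × 1# * fromℤ b)             ≈⟨ -‿distribˡ-* _ _ ⟩
    - (suc m × 1#) * fromℤ b             ∎

  fromℤ-morphism : ACR._-Raw-AlmostCommutative⟶_ ℤ.+-*-rawRing (ACR.fromCommutativeRing R)
  fromℤ-morphism = record
    { ⟦_⟧    = fromℤ
    ; +-homo = fromℤ-homo-+
    ; *-homo = fromℤ-homo-*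
    ; -‿homo = fromℤ-homo-neg
    ; 0-homo = refl
    ; 1-homo = +-identityʳ 1#
    }

  fromℤ-≟ : ∀ a b → Maybe (fromℤ a ≈ fromℤ b)
  fromℤ-≟ a b with a ℤ.≟ b
  ... | yes ≡.refl = just refl
  ... | no _       = nothing

  open Algebra.Solver.Ring ℤ.+-*-rawRing (ACR.fromCommutativeRing R) fromℤ-morphism fromℤ-≟ public

module UnitPowers {c ℓ} (R : CommutativeRing c ℓ) where
  open CommutativeRing R
  open import Algebra.Properties.Semiring.Exp semiring using (_^_; ^-congˡ)
  open import Algebra.Properties.CommutativeSemiring.Exp commutativeSemiring using (^-distrib-*)
  open import Algebra.Properties.CommutativeSemigroup *-commutativeSemigroup using (x∙yz≈y∙xz)
  open import Relation.Binary.Reasoning.Setoid setoid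

  -- x' plays the role of x⁻¹.
  powᶻ : Carrier → Carrier → ℤ → Carrier
  powᶻ x x' (+ n)    = x ^ n
  powᶻ x x' -[1+ n ] = x' ^ suc n

  powᶻ-cong : ∀ {x x' y y'} a → x ≈ y → x' ≈ y' → powᶻ x x' a ≈ powᶻ y y' a
  powᶻ-cong (+ n)    x≈y _     = ^-congˡ n x≈y
  powᶻ-cong -[1+ n ] _   x'≈y' = ^-congˡ (suc n) x'≈y'

  powᶻ-distrib-* : ∀ x x' y y' a → powᶻ (x * y) (x' * y') a ≈ powᶻ x x' a * powᶻ y y' a
  powᶻ-distrib-* x x' y y' (+ n)    = ^-distrib-* x y n
  powᶻ-distrib-* x x' y y' -[1+ n ] = ^-distrib-* x' y' (suc n)

  module _ {x x' : Carrier} (x*x'≈1 : x * x' ≈ 1#) where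

    private
      pow = powᶻ x x'

      cancelˡ : ∀ y → x * (x' * y) ≈ y
      cancelˡ y = trans (sym (*-assoc _ _ _)) (trans (*-congʳ x*x'≈1) (*-identityˡ y))

      cancelʳ : ∀ y → x' * (x * y) ≈ y
      cancelʳ y = trans (x∙yz≈y∙xz _ _ _) (cancelˡ y)

    powᶻ-suc : ∀ a → pow (ℤ.suc a) ≈ x * pow a
    powᶻ-suc (+ n)          = refl
    powᶻ-suc -[1+ zero ]    = sym (trans (*-congˡ (*-identityʳ x')) x*x'≈1)
    powᶻ-suc -[1+ suc n ]   = sym (cancelˡ _)

    powᶻ-pred : ∀ a → pow (ℤ.pred a) ≈ x' * pow a
    powᶻ-pred a = begin
      pow (ℤ.pred a)                   ≈⟨ cancelʳ _ ⟨
      x' * (x * pow (ℤ.pred a))        ≈⟨ *-congˡ (powᶻ-suc (ℤ.pred a)) ⟨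
      x' * pow (ℤ.suc (ℤ.pred a))      ≡⟨ ≡.cong (λ b → x' * pow b) (ℤ.suc-pred a) ⟩
      x' * pow a                       ∎

    powᶻ-homo-* : ∀ a b → pow (a ℤ.+ b) ≈ pow a * pow b
    powᶻ-homo-* a (+ zero) = trans (reflexive (≡.cong pow (ℤ.+-identityʳ a))) (sym (*-identityʳ _))
    powᶻ-homo-* a (+ suc n) = begin
      pow (a ℤ.+ + suc n)              ≡⟨ ≡.cong pow (shift a (+ n)) ⟩
      pow (ℤ.suc (a ℤ.+ + n))          ≈⟨ powᶻ-suc (a ℤ.+ + n) ⟩
      x * pow (a ℤ.+ + n)              ≈⟨ *-congˡ (powᶻ-homo-* a (+ n)) ⟩
      x * (pow a * x ^ n)              ≈⟨ x∙yz≈y∙xz _ _ _ ⟩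
      pow a * (x * x ^ n)              ∎
      where
      shift : ∀ a b → a ℤ.+ (+ 1 ℤ.+ b) ≡ + 1 ℤ.+ (a ℤ.+ b)
      shift = solve-∀
    powᶻ-homo-* a -[1+ zero ] = begin
      pow (a ℤ.+ ℤ.-1ℤ)                ≡⟨ ≡.cong pow (ℤ.+-comm a ℤ.-1ℤ) ⟩
      pow (ℤ.pred a)                   ≈⟨ powᶻ-pred a ⟩
      x' * pow a                       ≈⟨ *-comm _ _ ⟩
      pow a * x'                       ≈⟨ *-congˡ (*-identityʳ x') ⟨
      pow a * (x' * 1#)                ∎
    powᶻ-homo-* a -[1+ suc n ] = begin
      pow (a ℤ.+ -[1+ suc n ])         ≡⟨ ≡.cong pow (shift a -[1+ n ]) ⟩
      pow (ℤ.pred (a ℤ.+ -[1+ n ]))    ≈⟨ powᶻ-pred (a ℤ.+ -[1+ n ]) ⟩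
      x' * pow (a ℤ.+ -[1+ n ])        ≈⟨ *-congˡ (powᶻ-homo-* a -[1+ n ]) ⟩
      x' * (pow a * x' ^ suc n)        ≈⟨ x∙yz≈y∙xz _ _ _ ⟩
      pow a * (x' * x' ^ suc n)        ∎
      where
      shift : ∀ a b → a ℤ.+ (ℤ.-1ℤ ℤ.+ b) ≡ ℤ.-1ℤ ℤ.+ (a ℤ.+ b)
      shift = solve-∀

    powᶻ-assocʳ : ∀ a k → pow a ^ k ≈ pow (a ℤ.* + k)
    powᶻ-assocʳ a zero    = reflexive (≡.cong pow (≡.sym (ℤ.*-zeroʳ a)))
    powᶻ-assocʳ a (suc k) = begin
      pow a * pow a ^ k                ≈⟨ *-congˡ (powᶻ-assocʳ a k) ⟩
      pow a * pow (a ℤ.* + k)          ≈⟨ powᶻ-homo-* a (a ℤ.* + k) ⟨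
      pow (a ℤ.+ a ℤ.* + k)            ≡⟨ ≡.cong pow (expand a (+ k)) ⟩
      pow (a ℤ.* + suc k)              ∎
      where
      expand : ∀ a b → a ℤ.+ a ℤ.* b ≡ a ℤ.* (+ 1 ℤ.+ b)
      expand = solve-∀

    powᶻ-inverseˡ : ∀ a → pow (ℤ.- a) * pow a ≈ 1#
    powᶻ-inverseˡ a = trans (sym (powᶻ-homo-* (ℤ.- a) a)) (reflexive (≡.cong pow (ℤ.+-inverseˡ a)))

module SecondOrderRecurrence {c ℓ} (R : CommutativeRing c ℓ) (P Q : CommutativeRing.Carrier R) where

  open CommutativeRing R
  open IntegerCoefficientSolver R using (solve; _:+_; _:*_; _:-_; _:=_)
  open UnitPowers R using (powᶻ; powᶻ-suc)
  open import Data.Product using (_×_; _,_; proj₁)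
  open import Relation.Binary.Reasoning.Setoid setoid

  IsSolution : (ℤ → Carrier) → Set ℓ
  IsSolution f = ∀ m → f (ℤ.suc (ℤ.suc m)) ≈ P * f (ℤ.suc m) - Q * f m

  module _ {Q' : Carrier} (Q*Q'≈1 : Q * Q' ≈ 1#) where

    solution-backward : ∀ {f} → IsSolution f → ∀ m → f m ≈ Q' * (P * f (ℤ.suc m) - f (ℤ.suc (ℤ.suc m)))
    solution-backward {f} f-sol m = sym (begin
      Q' * (P * f₁ - f₂)                 ≈⟨ *-congˡ (+-congˡ (-‿cong (f-sol m))) ⟩
      Q' * (P * f₁ - (P * f₁ - Q * f m)) ≈⟨ *-congˡ (solve 2 (λ a b → a :- (a :- b) := b) refl (P * f₁) (Q * f m)) ⟩
      Q' * (Q * f m)                     ≈⟨ *-assoc _ _ _ ⟨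
      Q' * Q * f m                       ≈⟨ *-congʳ (trans (*-comm _ _) Q*Q'≈1) ⟩
      1# * f m                           ≈⟨ *-identityˡ _ ⟩
      f m                                ∎)
      where
      f₁ = f (ℤ.suc m)
      f₂ = f (ℤ.suc (ℤ.suc m))

    solution-unique : ∀ {f g} → IsSolution f → IsSolution g → f (+ 0) ≈ g (+ 0) → f (+ 1) ≈ g (+ 1) → ∀ m → f m ≈ g m
    solution-unique {f} {g} f-sol g-sol f₀≈g₀ f₁≈g₁ (+ n)    = proj₁ (forward n)
      where
      forward : ∀ n → f (+ n) ≈ g (+ n) × f (+ suc n) ≈ g (+ suc n)
      forward zero    = f₀≈g₀ , f₁≈g₁
      forward (suc n) = let eₙ , eₙ₊₁ = forward n in
        eₙ₊₁ , trans (f-sol (+ n)) (trans (+-cong (*-congˡ eₙ₊₁) (-‿cong (*-congˡ eₙ))) (sym (g-sol (+ n))))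
    solution-unique {f} {g} f-sol g-sol f₀≈g₀ f₁≈g₁ -[1+ n ] = proj₁ (backward n)
      where
      step : ∀ m → f (ℤ.suc m) ≈ g (ℤ.suc m) → f (ℤ.suc (ℤ.suc m)) ≈ g (ℤ.suc (ℤ.suc m)) → f m ≈ g m
      step m e₁ e₂ = trans (solution-backward f-sol m)
        (trans (*-congˡ (+-cong (*-congˡ e₁) (-‿cong e₂))) (sym (solution-backward g-sol m)))
      backward : ∀ n → f -[1+ n ] ≈ g -[1+ n ] × f (ℤ.suc -[1+ n ]) ≈ g (ℤ.suc -[1+ n ])
      backward zero    = step -[1+ 0 ] f₀≈g₀ f₁≈g₁ , f₀≈g₀
      backward (suc n) = let eₙ , eₙ₊₁ = backward n in step -[1+ suc n ] eₙ eₙ₊₁ , eₙ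

  +-solution : ∀ {f g} → IsSolution f → IsSolution g → IsSolution (λ m → f m + g m)
  +-solution f-sol g-sol m = trans (+-cong (f-sol m) (g-sol m))
    (solve 6 (λ P Q a b c d → (P :* a :- Q :* b) :+ (P :* c :- Q :* d) := P :* (a :+ c) :- Q :* (b :+ d)) refl _ _ _ _ _ _)

  *-solution : ∀ {f} y → IsSolution f → IsSolution (λ m → y * f m)
  *-solution y f-sol m = trans (*-congˡ (f-sol m))
    (solve 5 (λ P Q a b y → y :* (P :* a :- Q :* b) := P :* (y :* a) :- Q :* (y :* b)) refl _ _ _ _ _)

  powᶻ-solution : ∀ {x x'} (x*x'≈1 : x * x' ≈ 1#) → x * x ≈ P * x - Q → IsSolution (powᶻ x x')
  powᶻ-solution {x} {x'} x*x'≈1 x²≈Px-Q m = begin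
    pow (ℤ.suc (ℤ.suc m))             ≈⟨ powᶻ-suc x*x'≈1 (ℤ.suc m) ⟩
    x * pow (ℤ.suc m)                 ≈⟨ *-congˡ (powᶻ-suc x*x'≈1 m) ⟩
    x * (x * pow m)                   ≈⟨ *-assoc _ _ _ ⟨
    x * x * pow m                     ≈⟨ *-congʳ x²≈Px-Q ⟩
    (P * x - Q) * pow m               ≈⟨ solve 4 (λ P Q x a → (P :* x :- Q) :* a := P :* (x :* a) :- Q :* a) refl P Q x (pow m) ⟩
    P * (x * pow m) - Q * pow m       ≈⟨ +-congʳ (*-congˡ (powᶻ-suc x*x'≈1 m)) ⟨
    P * pow (ℤ.suc m) - Q * pow m     ∎
    where pow = powᶻ x x'

-- R[√D] is R × R with (a , b) standing for a + b √D.
module QuadraticExtension {c ℓ} (R : CommutativeRing c ℓ) (D : CommutativeRing.Carrier R) where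
  open CommutativeRing R
  open import Data.Product using (_×_; _,_; proj₁)
  open IntegerCoefficientSolver R using (solve; _:+_; _:*_; _:=_)

  private
    _⊗_ : Carrier × Carrier → Carrier × Carrier → Carrier × Carrier
    (a , b) ⊗ (a' , b') = (a * a' + D * (b * b') , a * b' + b * a')

    R² : AbelianGroup c ℓ
    R² = abelianGroup +-abelianGroup +-abelianGroup

    D*0≈0 : ∀ {x} → x ≈ 0# → D * x ≈ 0#
    D*0≈0 x≈0 = trans (*-congˡ x≈0) (zeroʳ D)

  abstract
    R[√D] : CommutativeRing c ℓ
    R[√D] = record
      { _*_ = _⊗_
      ; 1#  = (1# , 0#)
      ; isCommutativeRing = record
        { isRing = record
          { +-isAbelianGroup = AbelianGroup.isAbelianGroup R²
          ; *-cong     = λ (e₁ , e₂) (f₁ , f₂) → +-cong (*-cong e₁ f₁) (*-congˡ (*-cong e₂ f₂)) , +-cong (*-cong e₁ f₂) (*-cong e₂ f₁)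
          ; *-assoc    = λ (a , b) (a' , b') (a'' , b'') →
              solve 7 (λ D a b a' b' a'' b'' → (a :* a' :+ D :* (b :* b')) :* a'' :+ D :* ((a :* b' :+ b :* a') :* b'')
                                          := a :* (a' :* a'' :+ D :* (b' :* b'')) :+ D :* (b :* (a' :* b'' :+ b' :* a''))) refl D a b a' b' a'' b''
            , solve 7 (λ D a b a' b' a'' b'' → (a :* a' :+ D :* (b :* b')) :* b'' :+ (a :* b' :+ b :* a') :* a''
                                          := a :* (a' :* b'' :+ b' :* a'') :+ b :* (a' :* a'' :+ D :* (b' :* b''))) refl D a b a' b' a'' b''
          ; *-identity = (λ (a , b) → trans (+-cong (*-identityˡ a) (D*0≈0 (zeroˡ b))) (+-identityʳ a)
                                     , trans (+-cong (*-identityˡ b) (zeroˡ a)) (+-identityʳ b))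
                       , (λ (a , b) → trans (+-cong (*-identityʳ a) (D*0≈0 (zeroʳ b))) (+-identityʳ a)
                                     , trans (+-cong (zeroʳ a) (*-identityʳ b)) (+-identityˡ b))
          ; distrib    = (λ (a , b) (a' , b') (a'' , b'') →
                            solve 7 (λ D a b a' b' a'' b'' → a :* (a' :+ a'') :+ D :* (b :* (b' :+ b''))
                                          := (a :* a' :+ D :* (b :* b')) :+ (a :* a'' :+ D :* (b :* b''))) refl D a b a' b' a'' b''
                          , solve 6 (λ a b a' b' a'' b'' → a :* (b' :+ b'') :+ b :* (a' :+ a'')
                                          := (a :* b' :+ b :* a') :+ (a :* b'' :+ b :* a'')) refl a b a' b' a'' b'')
                       , (λ (a , b) (a' , b') (a'' , b'') →
                            solve 7 (λ D a b a' b' a'' b'' → (a' :+ a'') :* a :+ D :* ((b' :+ b'') :* b)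
                                          := (a' :* a :+ D :* (b' :* b)) :+ (a'' :* a :+ D :* (b'' :* b))) refl D a b a' b' a'' b''
                          , solve 6 (λ a b a' b' a'' b'' → (a' :+ a'') :* b :+ (b' :+ b'') :* a
                                          := (a' :* b :+ b' :* a) :+ (a'' :* b :+ b'' :* a)) refl a b a' b' a'' b'')
          }
        ; *-comm = λ (a , b) (a' , b') → solve 5 (λ D a b a' b' → a :* a' :+ D :* (b :* b') := a' :* a :+ D :* (b' :* b)) refl D a b a' b'
                                        , solve 4 (λ a b a' b' → a :* b' :+ b :* a' := a' :* b :+ b' :* a) refl a b a' b'
        }
      }

    ι : Carrier → CommutativeRing.Carrier R[√D]
    ι a = (a , 0#)

    √D : CommutativeRing.Carrier R[√D]
    √D = (0# , 1#)

  open CommutativeRing R[√D] using () renaming (_≈_ to _≈ᴱ_; _+_ to _+ᴱ_; _*_ to _*ᴱ_; -_ to -ᴱ_; 0# to 0ᴱ; 1# to 1ᴱ)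
  open import Algebra.Properties.Ring ring using (-0#≈0#)

  abstract
    ι-cong : ∀ {a b} → a ≈ b → ι a ≈ᴱ ι b
    ι-cong a≈b = a≈b , refl

    ι-injective : ∀ {a b} → ι a ≈ᴱ ι b → a ≈ b
    ι-injective = proj₁

    ι-homo-+ : ∀ a b → ι (a + b) ≈ᴱ ι a +ᴱ ι b
    ι-homo-+ a b = refl , sym (+-identityʳ 0#)

    ι-homo-* : ∀ a b → ι (a * b) ≈ᴱ ι a *ᴱ ι b
    ι-homo-* a b = sym (trans (+-congˡ (D*0≈0 (zeroˡ 0#))) (+-identityʳ _)) , sym (trans (+-cong (zeroʳ a) (zeroˡ b)) (+-identityʳ 0#))

    ι-homo-neg : ∀ a → ι (- a) ≈ᴱ -ᴱ ι a
    ι-homo-neg a = refl , sym -0#≈0#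

    ι-homo-0 : ι 0# ≈ᴱ 0ᴱ
    ι-homo-0 = refl , refl

    ι-homo-1 : ι 1# ≈ᴱ 1ᴱ
    ι-homo-1 = refl , refl

    √D*√D≈ιD : √D *ᴱ √D ≈ᴱ ι D
    √D*√D≈ιD = trans (+-cong (zeroˡ 0#) (*-congˡ (*-identityˡ 1#))) (trans (+-identityˡ _) (*-identityʳ D))
             , trans (+-cong (zeroˡ 1#) (zeroʳ 1#)) (+-identityʳ 0#)

    ι-*√D-injective : ∀ {a b} → ι a *ᴱ √D ≈ᴱ ι b *ᴱ √D → a ≈ b
    ι-*√D-injective {a} {b} (_ , e) = trans (sym (second a)) (trans e (second b))
      where
      second : ∀ x → x * 1# + 0# * 0# ≈ x
      second x = trans (+-cong (*-identityʳ x) (zeroˡ 0#)) (+-identityʳ x)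

module SymmetricBinomial {c ℓ} (R : CommutativeRing c ℓ) where
  open CommutativeRing R
  open import Algebra.Properties.Semiring.Exp semiring using (_^_)
  open import Algebra.Properties.Semiring.Sum semiring using (sum⁺-syntax; ∑-distrib-+; sum-cong-≋)
  open import Algebra.Properties.CommutativeMonoid.Mult +-commutativeMonoid using (_×_; ×-distrib-+; ×-congʳ)
  open import Algebra.Properties.CommutativeSemiring.Binomial commutativeSemiring using (theorem)
  open import Relation.Binary.Reasoning.Setoid setoid

  binomial-symmetric : ∀ N x y → (x + y) ^ N + (y + x) ^ N ≈
    ∑[ k ≤ N ] ((N C toℕ k) × (x ^ (N ∸ toℕ k) * y ^ toℕ k + y ^ (N ∸ toℕ k) * x ^ toℕ k))
  binomial-symmetric N x y = begin
    (x + y) ^ N + (y + x) ^ N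
      ≈⟨ +-comm _ _ ⟩
    (y + x) ^ N + (x + y) ^ N
      ≈⟨ +-cong (theorem N y x) (theorem N x y) ⟩
    (∑[ k ≤ N ] ((N C toℕ k) × (y ^ toℕ k * x ^ (N ∸ toℕ k)))) + (∑[ k ≤ N ] ((N C toℕ k) × (x ^ toℕ k * y ^ (N ∸ toℕ k))))
      ≈⟨ ∑-distrib-+ {suc N} (λ k → (N C toℕ k) × (y ^ toℕ k * x ^ (N ∸ toℕ k))) (λ k → (N C toℕ k) × (x ^ toℕ k * y ^ (N ∸ toℕ k))) ⟨
    ∑[ k ≤ N ] ((N C toℕ k) × (y ^ toℕ k * x ^ (N ∸ toℕ k)) + (N C toℕ k) × (x ^ toℕ k * y ^ (N ∸ toℕ k)))
      ≈⟨ sum-cong-≋ {suc N} regroup ⟩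
    ∑[ k ≤ N ] ((N C toℕ k) × (x ^ (N ∸ toℕ k) * y ^ toℕ k + y ^ (N ∸ toℕ k) * x ^ toℕ k)) ∎
    where
    regroup : ∀ k → (N C toℕ k) × (y ^ toℕ k * x ^ (N ∸ toℕ k)) + (N C toℕ k) × (x ^ toℕ k * y ^ (N ∸ toℕ k))
                  ≈ (N C toℕ k) × (x ^ (N ∸ toℕ k) * y ^ toℕ k + y ^ (N ∸ toℕ k) * x ^ toℕ k)
    regroup k = sym (trans (×-distrib-+ _ _ (N C toℕ k))
      (+-cong (×-congʳ (N C toℕ k) (*-comm (x ^ (N ∸ toℕ k)) (y ^ toℕ k)))
              (×-congʳ (N C toℕ k) (*-comm (y ^ (N ∸ toℕ k)) (x ^ toℕ k)))))

module FieldProperties {c ℓ} (F : Field c ℓ) where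
  open Field F hiding (zero)
  open FieldOps F
  open import Algebra.Properties.Ring ring using (-‿+-comm; -‿distribʳ-*; -1*x≈-x; -‿involutive)
  open import Algebra.Properties.Semiring.Exp semiring using (_^_; ^-assocʳ; ^-congˡ)
  open IntegerCoefficientSolver commutativeRing using (solve; _:+_; _:=_)
  open UnitPowers commutativeRing using (powᶻ; powᶻ-homo-*)
  open import Relation.Binary.Reasoning.Setoid setoid

  ^ⁿ≡^ : ∀ x n → x ^ⁿ n ≡ x ^ n
  ^ⁿ≡^ x zero    = ≡.refl
  ^ⁿ≡^ x (suc n) = ≡.cong (x *_) (^ⁿ≡^ x n)

  ^ᶻ≡powᶻ : ∀ x a → x ^ᶻ a ≡ powᶻ x (x ⁻¹) a
  ^ᶻ≡powᶻ x (+ n)    = ^ⁿ≡^ x n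
  ^ᶻ≡powᶻ x -[1+ n ] = ^ⁿ≡^ (x ⁻¹) (suc n)

  1^ⁿn≈1 : ∀ n → 1# ^ⁿ n ≈ 1#
  1^ⁿn≈1 n = trans (reflexive (^ⁿ≡^ 1# n)) (^-assocʳ 1# 0 n)

  -1^ⁿ[2n]≈1 : ∀ n → (- 1#) ^ⁿ (2 ℕ.* n) ≈ 1#
  -1^ⁿ[2n]≈1 n = begin
    (- 1#) ^ⁿ (2 ℕ.* n)       ≡⟨ ^ⁿ≡^ (- 1#) (2 ℕ.* n) ⟩
    (- 1#) ^ (2 ℕ.* n)        ≈⟨ ^-assocʳ (- 1#) 2 n ⟨
    ((- 1#) ^ 2) ^ n          ≈⟨ ^-congˡ n (trans (*-congˡ (*-identityʳ _)) (trans (-1*x≈-x (- 1#)) (-‿involutive 1#))) ⟩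
    1# ^ n                    ≡⟨ ^ⁿ≡^ 1# n ⟨
    1# ^ⁿ n                   ≈⟨ 1^ⁿn≈1 n ⟩
    1#                        ∎

  -1^ⁿ[1+2n]≈-1 : ∀ n → (- 1#) ^ⁿ suc (2 ℕ.* n) ≈ - 1#
  -1^ⁿ[1+2n]≈-1 n = trans (*-congˡ (-1^ⁿ[2n]≈1 n)) (*-identityʳ _)

  ^ᶻ-homo-* : ∀ {x} → ¬ (x ≈ 0#) → ∀ a b → x ^ᶻ (a ℤ.+ b) ≈ x ^ᶻ a * x ^ᶻ b
  ^ᶻ-homo-* {x} x≉0 a b = begin
    x ^ᶻ (a ℤ.+ b)                           ≡⟨ ^ᶻ≡powᶻ x (a ℤ.+ b) ⟩
    powᶻ x (x ⁻¹) (a ℤ.+ b)                  ≈⟨ powᶻ-homo-* (inverseʳ x x≉0) a b ⟩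
    powᶻ x (x ⁻¹) a * powᶻ x (x ⁻¹) b        ≡⟨ ≡.cong₂ _*_ (^ᶻ≡powᶻ x a) (^ᶻ≡powᶻ x b) ⟨
    x ^ᶻ a * x ^ᶻ b                          ∎

  ^ⁿ-homo-* : ∀ x m n → x ^ⁿ (m ℕ.+ n) ≈ x ^ⁿ m * x ^ⁿ n
  ^ⁿ-homo-* x zero    n = sym (*-identityˡ _)
  ^ⁿ-homo-* x (suc m) n = trans (*-congˡ (^ⁿ-homo-* x m n)) (sym (*-assoc _ _ _))

  ÷-unique : ∀ {d s x} → ¬ (d ≈ 0#) → d * s ≈ x → s ≈ x ÷ d
  ÷-unique {d} {s} {x} d≉0 ds≈x = begin
    s                     ≈⟨ *-identityʳ s ⟨
    s * 1#                ≈⟨ *-congˡ (inverseʳ d d≉0) ⟨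
    s * (d * d ⁻¹)        ≈⟨ *-assoc _ _ _ ⟨
    s * d * d ⁻¹          ≈⟨ *-congʳ (trans (*-comm s d) ds≈x) ⟩
    x ÷ d                 ∎

  Σ-cong : ∀ m {f g} → (∀ i → i ℕ.≤ m → f i ≈ g i) → Σ[0… m ] f ≈ Σ[0… m ] g
  Σ-cong zero    f≈g = f≈g zero ℕ.z≤n
  Σ-cong (suc m) f≈g = +-cong (Σ-cong m (λ i i≤m → f≈g i (ℕ.m≤n⇒m≤1+n i≤m))) (f≈g (suc m) ℕ.≤-refl)

  Σ<-cong : ∀ m {f g} → (∀ i → f i ≈ g i) → Σ[0…< m ] f ≈ Σ[0…< m ] g
  Σ<-cong zero    f≈g = refl
  Σ<-cong (suc m) f≈g = +-cong (Σ<-cong m f≈g) (f≈g m)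

  Σᶻ-cong : ∀ k {f g} → (∀ j → f j ≈ g j) → Σᶻ[0… k ] f ≈ Σᶻ[0… k ] g
  Σᶻ-cong (+ m)    f≈g = Σ-cong m (λ j _ → f≈g (+ j))
  Σᶻ-cong -[1+ m ] f≈g = -‿cong (Σ<-cong m (λ t → f≈g -[1+ t ]))

  private
    interchange : ∀ a b a' b' → (a + b) + (a' + b') ≈ (a + a') + (b + b')
    interchange = solve 4 (λ a b a' b' → (a :+ b) :+ (a' :+ b') := (a :+ a') :+ (b :+ b')) refl

  Σ-distrib-+ : ∀ m f g → Σ[0… m ] (λ i → f i + g i) ≈ Σ[0… m ] f + Σ[0… m ] g
  Σ-distrib-+ zero    f g = refl
  Σ-distrib-+ (suc m) f g = trans (+-congʳ (Σ-distrib-+ m f g)) (interchange _ _ _ _)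

  Σ-neg : ∀ m f → Σ[0… m ] (λ i → - f i) ≈ - Σ[0… m ] f
  Σ-neg zero    f = refl
  Σ-neg (suc m) f = trans (+-congʳ (Σ-neg m f)) (-‿+-comm _ _)

  Σ-distrib-- : ∀ m f g → Σ[0… m ] (λ i → f i - g i) ≈ Σ[0… m ] f - Σ[0… m ] g
  Σ-distrib-- m f g = trans (Σ-distrib-+ m f (λ i → - g i)) (+-congˡ (Σ-neg m g))

  *-distribˡ-Σ : ∀ m x f → x * Σ[0… m ] f ≈ Σ[0… m ] (λ i → x * f i)
  *-distribˡ-Σ zero    x f = refl
  *-distribˡ-Σ (suc m) x f = trans (distribˡ _ _ _) (+-congʳ (*-distribˡ-Σ m x f))

  *-distribˡ-Σ< : ∀ m x f → x * Σ[0…< m ] f ≈ Σ[0…< m ] (λ i → x * f i)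
  *-distribˡ-Σ< zero    x f = zeroʳ x
  *-distribˡ-Σ< (suc m) x f = trans (distribˡ _ _ _) (+-congʳ (*-distribˡ-Σ< m x f))

  *-distribˡ-Σᶻ : ∀ k x f → x * Σᶻ[0… k ] f ≈ Σᶻ[0… k ] (λ j → x * f j)
  *-distribˡ-Σᶻ (+ m)    x f = *-distribˡ-Σ m x (λ j → f (+ j))
  *-distribˡ-Σᶻ -[1+ m ] x f = trans (sym (-‿distribʳ-* _ _)) (-‿cong (*-distribˡ-Σ< m x _))

  Σ-zero : ∀ m → Σ[0… m ] (λ _ → 0#) ≈ 0#
  Σ-zero zero    = refl
  Σ-zero (suc m) = trans (+-identityʳ _) (Σ-zero m)

  Σ-comm : ∀ m n (f : ℕ → ℕ → Carrier) → Σ[0… m ] (λ j → Σ[0… n ] (λ i → f i j)) ≈ Σ[0… n ] (λ i → Σ[0… m ] (f i))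
  Σ-comm zero    n f = refl
  Σ-comm (suc m) n f = trans (+-congʳ (Σ-comm m n f)) (sym (Σ-distrib-+ n _ _))

  Σ<-comm-Σ : ∀ m n (f : ℕ → ℕ → Carrier) → Σ[0…< m ] (λ j → Σ[0… n ] (λ i → f i j)) ≈ Σ[0… n ] (λ i → Σ[0…< m ] (f i))
  Σ<-comm-Σ zero    n f = sym (Σ-zero n)
  Σ<-comm-Σ (suc m) n f = trans (+-congʳ (Σ<-comm-Σ m n f)) (sym (Σ-distrib-+ n _ _))

  Σᶻ-comm-Σ : ∀ k n (f : ℕ → ℤ → Carrier) → Σᶻ[0… k ] (λ j → Σ[0… n ] (λ i → f i j)) ≈ Σ[0… n ] (λ i → Σᶻ[0… k ] (f i))
  Σᶻ-comm-Σ (+ m)    n f = Σ-comm m n (λ i j → f i (+ j))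
  Σᶻ-comm-Σ -[1+ m ] n f = trans (-‿cong (Σ<-comm-Σ m n (λ i t → f i -[1+ t ]))) (sym (Σ-neg n _))

module Telescoping {c ℓ} (F : Field c ℓ) where
  open Field F hiding (zero)
  open FieldOps F
  open FieldProperties F using (^ⁿ-homo-*; ^ᶻ-homo-*)
  open IntegerCoefficientSolver commutativeRing using (solve; _:+_; _:*_; _:-_; :-_; _:=_; con)
  open import Relation.Binary.Reasoning.Setoid setoid

  module ForRecurrence (P Q : Carrier) (w : ℤ → Carrier)
    (w-rec : ∀ j → w (ℤ.suc j) ≈ P * w j - Q * w (ℤ.pred j)) (z : Carrier) where

    boundary : ℤ → Carrier
    boundary k = Q * w k * z ^ᶻ (k ℤ.+ + 2) - w (ℤ.suc k) * z ^ᶻ (k ℤ.+ + 1)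

    denominator : Carrier
    denominator = Q * (z * z) - P * z + 1#

    private
      ZShift : ℤ → Set ℓ
      ZShift k = z ^ᶻ (k ℤ.+ + 1) ≈ z ^ᶻ k * z

      z-shift⁺ : ∀ j → ZShift (+ j)
      z-shift⁺ j = trans (^ⁿ-homo-* z j 1) (*-congˡ (*-identityʳ z))

      z-shift : ¬ (z ≈ 0#) → ∀ k → ZShift k
      z-shift z≉0 k = trans (^ᶻ-homo-* z≉0 k (+ 1)) (*-congˡ (*-identityʳ z))

      [k-1]+1≡k : ∀ k → (ℤ.-1ℤ ℤ.+ k) ℤ.+ + 1 ≡ k
      [k-1]+1≡k = solve-∀

      [k-1]+2≡k+1 : ∀ k → (ℤ.-1ℤ ℤ.+ k) ℤ.+ + 2 ≡ k ℤ.+ + 1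
      [k-1]+2≡k+1 = solve-∀

      [k+1]+1≡k+2 : ∀ k → (k ℤ.+ + 1) ℤ.+ + 1 ≡ k ℤ.+ + 2
      [k+1]+1≡k+2 = solve-∀

      step : ∀ k → ZShift k → ZShift (k ℤ.+ + 1) →
             boundary k - boundary (ℤ.pred k) ≈ denominator * (w k * z ^ᶻ k)
      step k shiftₖ shiftₖ₊₁ = begin
        boundary k - boundary (ℤ.pred k)
          ≈⟨ +-cong (+-cong (*-congˡ zᵏ⁺²) (-‿cong (*-cong (w-rec k) shiftₖ))) (-‿cong boundary[k-1]) ⟩
        Q * wₖ * (zᵏ * (z * z)) - (P * wₖ - Q * wₖ₋₁) * (zᵏ * z) - (Q * wₖ₋₁ * (zᵏ * z) - wₖ * zᵏ)
          ≈⟨ solve 6 (λ Q P z wₖ wₖ₋₁ zᵏ → Q :* wₖ :* (zᵏ :* (z :* z)) :- (P :* wₖ :- Q :* wₖ₋₁) :* (zᵏ :* z) :- (Q :* wₖ₋₁ :* (zᵏ :* z) :- wₖ :* zᵏ)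
                                        := (Q :* (z :* z) :- P :* z) :* (wₖ :* zᵏ) :+ wₖ :* zᵏ) refl Q P z wₖ wₖ₋₁ zᵏ ⟩
        (Q * (z * z) - P * z) * (wₖ * zᵏ) + wₖ * zᵏ
          ≈⟨ +-congˡ (*-identityˡ _) ⟨
        (Q * (z * z) - P * z) * (wₖ * zᵏ) + 1# * (wₖ * zᵏ)
          ≈⟨ distribʳ _ _ _ ⟨
        denominator * (wₖ * zᵏ) ∎
        where
        wₖ = w k
        wₖ₋₁ = w (ℤ.pred k)
        zᵏ = z ^ᶻ k
        zᵏ⁺² : z ^ᶻ (k ℤ.+ + 2) ≈ zᵏ * (z * z)
        zᵏ⁺² = begin
          z ^ᶻ (k ℤ.+ + 2)              ≡⟨ ≡.cong (z ^ᶻ_) ([k+1]+1≡k+2 k) ⟨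
          z ^ᶻ (k ℤ.+ + 1 ℤ.+ + 1)      ≈⟨ shiftₖ₊₁ ⟩
          z ^ᶻ (k ℤ.+ + 1) * z          ≈⟨ *-congʳ shiftₖ ⟩
          zᵏ * z * z                    ≈⟨ *-assoc _ _ _ ⟩
          zᵏ * (z * z)                  ∎
        boundary[k-1] : boundary (ℤ.pred k) ≈ Q * wₖ₋₁ * (zᵏ * z) - wₖ * zᵏ
        boundary[k-1] = begin
          Q * wₖ₋₁ * z ^ᶻ (ℤ.pred k ℤ.+ + 2) - w (ℤ.suc (ℤ.pred k)) * z ^ᶻ (ℤ.pred k ℤ.+ + 1)
            ≡⟨ ≡.cong₂ (λ a b → Q * wₖ₋₁ * z ^ᶻ a - w b * z ^ᶻ (ℤ.pred k ℤ.+ + 1)) ([k-1]+2≡k+1 k) (ℤ.suc-pred k) ⟩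
          Q * wₖ₋₁ * z ^ᶻ (k ℤ.+ + 1) - wₖ * z ^ᶻ (ℤ.pred k ℤ.+ + 1)
            ≡⟨ ≡.cong (λ a → Q * wₖ₋₁ * z ^ᶻ (k ℤ.+ + 1) - wₖ * z ^ᶻ a) ([k-1]+1≡k k) ⟩
          Q * wₖ₋₁ * z ^ᶻ (k ℤ.+ + 1) - wₖ * zᵏ
            ≈⟨ +-congʳ (*-congˡ shiftₖ) ⟩
          Q * wₖ₋₁ * (zᵏ * z) - wₖ * zᵏ ∎

      d*-0≈a-a : ∀ a → denominator * (- 0#) ≈ a - a
      d*-0≈a-a = solve 2 (λ d a → d :* (:- con (+ 0)) := a :- a) refl denominator

      telescope⁺ : ∀ m → denominator * Σ[0… m ] (λ j → w (+ j) * z ^ᶻ (+ j)) ≈ boundary (+ m) - boundary -[1+ 0 ]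
      telescope⁺ zero    = sym (step (+ 0) (z-shift⁺ 0) (z-shift⁺ 1))
      telescope⁺ (suc m) = begin
        denominator * (Σ[0… m ] (λ j → w (+ j) * z ^ᶻ (+ j)) + w (+ suc m) * z ^ᶻ (+ suc m))
          ≈⟨ distribˡ _ _ _ ⟩
        denominator * Σ[0… m ] (λ j → w (+ j) * z ^ᶻ (+ j)) + denominator * (w (+ suc m) * z ^ᶻ (+ suc m))
          ≈⟨ +-cong (telescope⁺ m) (sym (step (+ suc m) (z-shift⁺ (suc m)) (z-shift⁺ (suc m ℕ.+ 1)))) ⟩
        (boundary (+ m) - boundary -[1+ 0 ]) + (boundary (+ suc m) - boundary (+ m))
          ≈⟨ solve 3 (λ a b c → (a :- b) :+ (c :- a) := c :- b) refl _ _ _ ⟩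
        boundary (+ suc m) - boundary -[1+ 0 ] ∎

      telescope⁻ : ¬ (z ≈ 0#) → ∀ m → denominator * (- Σ[0…< m ] (λ t → w -[1+ t ] * z ^ᶻ -[1+ t ])) ≈ boundary -[1+ m ] - boundary -[1+ 0 ]
      telescope⁻ z≉0 zero    = d*-0≈a-a _
      telescope⁻ z≉0 (suc m) = begin
        denominator * (- (Σ[0…< m ] (λ t → w -[1+ t ] * z ^ᶻ -[1+ t ]) + w -[1+ m ] * z ^ᶻ -[1+ m ]))
          ≈⟨ solve 3 (λ d a b → d :* (:- (a :+ b)) := d :* (:- a) :- d :* b) refl denominator _ _ ⟩
        denominator * (- Σ[0…< m ] (λ t → w -[1+ t ] * z ^ᶻ -[1+ t ])) - denominator * (w -[1+ m ] * z ^ᶻ -[1+ m ])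
          ≈⟨ +-cong (telescope⁻ z≉0 m) (-‿cong (sym (step -[1+ m ] (z-shift z≉0 -[1+ m ]) (z-shift z≉0 (-[1+ m ] ℤ.+ + 1))))) ⟩
        (boundary -[1+ m ] - boundary -[1+ 0 ]) - (boundary -[1+ m ] - boundary -[1+ suc m ])
          ≈⟨ solve 3 (λ a b c → (a :- b) :- (a :- c) := c :- b) refl _ _ _ ⟩
        boundary -[1+ suc m ] - boundary -[1+ 0 ] ∎

    telescoping : ∀ k → (k ℤ.< -[1+ 0 ] → ¬ (z ≈ 0#)) →
                  denominator * Σᶻ[0… k ] (λ j → w j * z ^ᶻ j) ≈ boundary k - boundary -[1+ 0 ]
    telescoping (+ m)          _        = telescope⁺ m
    telescoping -[1+ zero ]    _        = d*-0≈a-a _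
    telescoping -[1+ suc m ]   k<-1⇒z≉0 = telescope⁻ (k<-1⇒z≉0 (ℤ.-<- (ℕ.s≤s ℕ.z≤n))) (suc m)

N-2i : ℕ → ℕ → ℤ
N-2i N i = + N ℤ.- + 2 ℤ.* + i

m[N∸i]≡m[N-2i]+mi : ∀ {N i} → i ℕ.≤ N → ∀ m → m ℤ.* + (N ∸ i) ≡ m ℤ.* N-2i N i ℤ.+ m ℤ.* + i
m[N∸i]≡m[N-2i]+mi {N} {i} i≤N m = ≡.trans (≡.cong (m ℤ.*_) +[N∸i]≡N-i) (expand m (+ N) (+ i))
  where
  +[N∸i]≡N-i : + (N ∸ i) ≡ + N ℤ.- + i
  +[N∸i]≡N-i = ≡.trans (≡.sym (ℤ.⊖-≥ i≤N)) (≡.sym (ℤ.m-n≡m⊖n N i))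
  expand : ∀ m n i → m ℤ.* (n ℤ.- i) ≡ m ℤ.* (n ℤ.- + 2 ℤ.* i) ℤ.+ m ℤ.* i
  expand = solve-∀

module LucasRecurrence {c ℓ} (F : Field c ℓ) (p q : Field.Carrier F) (q≉0 : ¬ (Field._≈_ F q (Field.0# F))) where
  open Field F hiding (zero)
  open FieldOps F
  open Lucas F p q
  open IntegerCoefficientSolver commutativeRing using (solve; _:-_; _:=_)
  open SecondOrderRecurrence commutativeRing p q public

  private
    backward-step : ∀ x y → p * y - q * ((p * y - x) ÷ q) ≈ x
    backward-step x y = trans (+-congˡ (-‿cong q[a÷q]≈a)) (solve 2 (λ a b → a :- (a :- b) := b) refl (p * y) x)
      where
      q[a÷q]≈a : q * ((p * y - x) ÷ q) ≈ p * y - x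
      q[a÷q]≈a = trans (sym (*-assoc _ _ _)) (trans (*-congʳ (*-comm _ _)) (trans (*-assoc _ _ _)
                   (trans (*-congˡ (inverseʳ q q≉0)) (*-identityʳ _))))

  seq-solution : ∀ a b → IsSolution (seq a b)
  seq-solution a b (+ n)              = refl
  seq-solution a b -[1+ zero ]        = sym (backward-step b a)
  seq-solution a b -[1+ suc zero ]    = sym (backward-step a (bwd a b 1))
  seq-solution a b -[1+ suc (suc n) ] = sym (backward-step (bwd a b (suc n)) (bwd a b (suc (suc n))))

module LucasBinet {c ℓ} (F : Field c ℓ) (p q : Field.Carrier F)
  (q≉0 : ¬ (Field._≈_ F q (Field.0# F)))
  (2≉0 : ¬ (Field._≈_ F (FieldOps.fromℕ F 2) (Field.0# F))) where

  private module F where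
    open Field F public
    open IntegerCoefficientSolver commutativeRing public using (solve; _:+_; _:*_; _:-_; _:=_; con)
    open import Algebra.Properties.Ring ring public using (-1*x≈-x; -‿involutive)
  open FieldOps F
  open Lucas F p q
  open FieldProperties F using (Σ-cong; 1^ⁿn≈1; -1^ⁿ[2n]≈1; -1^ⁿ[1+2n]≈-1)
  module FRec = LucasRecurrence F p q q≉0

  D : F.Carrier
  D = p F.* p F.- fromℕ 4 F.* q

  open QuadraticExtension F.commutativeRing D
  open CommutativeRing R[√D]
  open IntegerCoefficientSolver R[√D] using (solve; _:+_; _:*_; _:-_; _:=_; con)
  open UnitPowers R[√D]
  open import Algebra.Properties.Semiring.Exp semiring using (_^_; ^-congˡ; ^-homo-*; ^-assocʳ)
  open import Algebra.Properties.CommutativeSemiring.Exp commutativeSemiring using (^-distrib-*)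
  open import Algebra.Properties.Semiring.Mult semiring using (_×_; ×-congʳ; ×-assoc-*)
  open import Algebra.Properties.Semiring.Sum semiring using (sum⁺-syntax; sum-cong-≋; sum-init-last; *-distribˡ-sum)
  open SymmetricBinomial R[√D] using (binomial-symmetric)
  open import Algebra.Properties.Ring ring using (-1*x≈-x)
  open import Relation.Binary.Reasoning.Setoid setoid

  ι-homo-- : ∀ a b → ι (a F.- b) ≈ ι a - ι b
  ι-homo-- a b = trans (ι-homo-+ a (F.- b)) (+-congˡ (ι-homo-neg b))

  ι-homo-^ⁿ : ∀ a n → ι (a ^ⁿ n) ≈ ι a ^ n
  ι-homo-^ⁿ a zero    = ι-homo-1
  ι-homo-^ⁿ a (suc n) = trans (ι-homo-* a (a ^ⁿ n)) (*-congˡ (ι-homo-^ⁿ a n))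

  ι-homo-^ᶻ : ∀ a m → ι (a ^ᶻ m) ≈ powᶻ (ι a) (ι (a F.⁻¹)) m
  ι-homo-^ᶻ a (+ n)    = ι-homo-^ⁿ a n
  ι-homo-^ᶻ a -[1+ n ] = ι-homo-^ⁿ (a F.⁻¹) (suc n)

  ι-homo-fromℕ : ∀ n → ι (fromℕ n) ≈ n × 1#
  ι-homo-fromℕ zero    = ι-homo-0
  ι-homo-fromℕ (suc n) = trans (ι-homo-+ F.1# (fromℕ n)) (+-cong ι-homo-1 (ι-homo-fromℕ n))

  private
    h : F.Carrier
    h = fromℕ 2 F.⁻¹

    2h≈1 : fromℕ 2 F.* h F.≈ F.1#
    2h≈1 = F.inverseʳ _ 2≉0

    halves : ∀ x → x F.* h F.+ x F.* h F.≈ x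
    halves x = F.trans (F.solve 2 (λ x h → x F.:* h F.:+ x F.:* h F.:= (F.con (+ 2) F.:* h) F.:* x) F.refl x h)
                       (F.trans (F.*-congʳ 2h≈1) (F.*-identityˡ x))

    h+h≈1 : h F.+ h F.≈ F.1#
    h+h≈1 = F.trans (F.+-cong (F.sym (F.*-identityˡ h)) (F.sym (F.*-identityˡ h))) (halves F.1#)

    ph²-h²D≈q : (p F.* h) F.* (p F.* h) F.- (h F.* h) F.* D F.≈ q
    ph²-h²D≈q = F.trans
      (F.solve 3 (λ p q h → (p F.:* h) F.:* (p F.:* h) F.:- (h F.:* h) F.:* (p F.:* p F.:- F.con (+ 4) F.:* q)
                         F.:= ((F.con (+ 2) F.:* h) F.:* (F.con (+ 2) F.:* h)) F.:* q) F.refl p q h)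
      (F.trans (F.*-congʳ (F.*-cong 2h≈1 2h≈1)) (F.trans (F.*-congʳ (F.*-identityˡ F.1#)) (F.*-identityˡ q)))

  α β : Carrier
  α = ι (p F.* h) + ι h * √D
  β = ι (p F.* h) - ι h * √D

  α+β≈ιp : α + β ≈ ι p
  α+β≈ιp = begin
    α + β                         ≈⟨ solve 3 (λ a b s → (a :+ b :* s) :+ (a :- b :* s) := a :+ a) refl _ _ _ ⟩
    ι (p F.* h) + ι (p F.* h)     ≈⟨ ι-homo-+ _ _ ⟨
    ι (p F.* h F.+ p F.* h)       ≈⟨ ι-cong (halves p) ⟩
    ι p                           ∎

  α-β≈√D : α - β ≈ √D
  α-β≈√D = begin
    α - β                         ≈⟨ solve 3 (λ a b s → (a :+ b :* s) :- (a :- b :* s) := (b :+ b) :* s) refl _ _ _ ⟩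
    (ι h + ι h) * √D              ≈⟨ *-congʳ (trans (sym (ι-homo-+ h h)) (trans (ι-cong h+h≈1) ι-homo-1)) ⟩
    1# * √D                       ≈⟨ *-identityˡ √D ⟩
    √D                            ∎

  α*β≈ιq : α * β ≈ ι q
  α*β≈ιq = begin
    α * β                                              ≈⟨ solve 3 (λ a b s → (a :+ b :* s) :* (a :- b :* s) := a :* a :- (b :* b) :* (s :* s)) refl _ _ _ ⟩
    ι (p F.* h) * ι (p F.* h) - (ι h * ι h) * (√D * √D) ≈⟨ +-congˡ (-‿cong (*-cong (ι-homo-* h h) (sym √D*√D≈ιD))) ⟨
    ι (p F.* h) * ι (p F.* h) - ι (h F.* h) * ι D       ≈⟨ +-cong (ι-homo-* _ _) (-‿cong (ι-homo-* _ _)) ⟨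
    ι ((p F.* h) F.* (p F.* h)) - ι ((h F.* h) F.* D)   ≈⟨ ι-homo-- _ _ ⟨
    ι ((p F.* h) F.* (p F.* h) F.- (h F.* h) F.* D)     ≈⟨ ι-cong ph²-h²D≈q ⟩
    ι q                                                ∎

  private
    ιq*ιq⁻¹≈1 : ι q * ι (q F.⁻¹) ≈ 1#
    ιq*ιq⁻¹≈1 = trans (sym (ι-homo-* q (q F.⁻¹))) (trans (ι-cong (F.inverseʳ q q≉0)) ι-homo-1)

  open SecondOrderRecurrence R[√D] (ι p) (ι q)

  ι-solution : ∀ {f} → FRec.IsSolution f → IsSolution (λ m → ι (f m))
  ι-solution f-sol m = trans (ι-cong (f-sol m))
    (trans (ι-homo-- _ _) (+-cong (ι-homo-* p _) (-‿cong (ι-homo-* q _))))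

  α⁻¹ β⁻¹ : Carrier
  α⁻¹ = β * ι (q F.⁻¹)
  β⁻¹ = α * ι (q F.⁻¹)

  α*α⁻¹≈1 : α * α⁻¹ ≈ 1#
  α*α⁻¹≈1 = trans (sym (*-assoc _ _ _)) (trans (*-congʳ α*β≈ιq) ιq*ιq⁻¹≈1)

  β*β⁻¹≈1 : β * β⁻¹ ≈ 1#
  β*β⁻¹≈1 = trans (sym (*-assoc _ _ _)) (trans (*-congʳ (trans (*-comm β α) α*β≈ιq)) ιq*ιq⁻¹≈1)

  α⁻¹*β⁻¹≈ιq⁻¹ : α⁻¹ * β⁻¹ ≈ ι (q F.⁻¹)
  α⁻¹*β⁻¹≈ιq⁻¹ = begin
    β * ι (q F.⁻¹) * (α * ι (q F.⁻¹))         ≈⟨ solve 3 (λ b a r → b :* r :* (a :* r) := a :* b :* r :* r) refl β α _ ⟩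
    α * β * ι (q F.⁻¹) * ι (q F.⁻¹)           ≈⟨ *-congʳ (trans (*-congʳ α*β≈ιq) ιq*ιq⁻¹≈1) ⟩
    1# * ι (q F.⁻¹)                           ≈⟨ *-identityˡ _ ⟩
    ι (q F.⁻¹)                                ∎

  A B : ℤ → Carrier
  A = powᶻ α α⁻¹
  B = powᶻ β β⁻¹

  root-equation : ∀ {x y} → x + y ≈ ι p → x * y ≈ ι q → x * x ≈ ι p * x - ι q
  root-equation {x} {y} x+y≈ιp x*y≈ιq = trans (solve 2 (λ x y → x :* x := (x :+ y) :* x :- x :* y) refl x y)
    (+-cong (*-congʳ x+y≈ιp) (-‿cong x*y≈ιq))

  A-solution : IsSolution A
  A-solution = powᶻ-solution α*α⁻¹≈1 (root-equation α+β≈ιp α*β≈ιq)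

  B-solution : IsSolution B
  B-solution = powᶻ-solution β*β⁻¹≈1 (root-equation (trans (+-comm β α) α+β≈ιp) (trans (*-comm β α) α*β≈ιq))

  A*B≈ιq^ᶻ : ∀ m → A m * B m ≈ ι (q ^ᶻ m)
  A*B≈ιq^ᶻ m = begin
    A m * B m                                 ≈⟨ powᶻ-distrib-* α α⁻¹ β β⁻¹ m ⟨
    powᶻ (α * β) (α⁻¹ * β⁻¹) m                ≈⟨ powᶻ-cong m α*β≈ιq α⁻¹*β⁻¹≈ιq⁻¹ ⟩
    powᶻ (ι q) (ι (q F.⁻¹)) m                 ≈⟨ ι-homo-^ᶻ q m ⟨
    ι (q ^ᶻ m)                                ∎

  G : F.Carrier → ℤ → Carrier
  G ε m = A m + ι ε * B m

  Represents : F.Carrier → Carrier → (ℤ → F.Carrier) → Set ℓ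
  Represents ε w g = ∀ m → w * ι (g m) ≈ G ε m

  represents : ∀ {g} ε w → FRec.IsSolution g → w * ι (g (+ 0)) ≈ G ε (+ 0) → w * ι (g (+ 1)) ≈ G ε (+ 1) →
               Represents ε w g
  represents ε w g-sol =
    solution-unique ιq*ιq⁻¹≈1 (*-solution w (ι-solution g-sol)) (+-solution A-solution (*-solution (ι ε) B-solution))

  v-binet : Represents F.1# 1# v
  v-binet = represents F.1# 1# (FRec.seq-solution _ _) initial₀ initial₁
    where
    ι1*x≈x : ∀ x → ι F.1# * x ≈ x
    ι1*x≈x x = trans (*-congʳ ι-homo-1) (*-identityˡ x)
    initial₀ : 1# * ι (F.1# F.+ F.1#) ≈ 1# + ι F.1# * 1#
    initial₀ = begin
      1# * ι (F.1# F.+ F.1#)      ≈⟨ *-identityˡ _ ⟩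
      ι (F.1# F.+ F.1#)           ≈⟨ ι-homo-+ F.1# F.1# ⟩
      ι F.1# + ι F.1#             ≈⟨ +-cong (sym ι-homo-1) (*-identityʳ _) ⟨
      1# + ι F.1# * 1#            ∎
    initial₁ : 1# * ι p ≈ α * 1# + ι F.1# * (β * 1#)
    initial₁ = begin
      1# * ι p                    ≈⟨ *-identityˡ _ ⟩
      ι p                         ≈⟨ α+β≈ιp ⟨
      α + β                       ≈⟨ +-cong (*-identityʳ α) (trans (ι1*x≈x _) (*-identityʳ β)) ⟨
      α * 1# + ι F.1# * (β * 1#)  ∎

  u-binet : Represents (F.- F.1#) √D u
  u-binet = represents (F.- F.1#) √D (FRec.seq-solution _ _) initial₀ initial₁
    where
    ι-1*x≈-x : ∀ x → ι (F.- F.1#) * x ≈ - x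
    ι-1*x≈-x x = trans (*-congʳ (trans (ι-homo-neg F.1#) (-‿cong ι-homo-1))) (-1*x≈-x x)
    initial₀ : √D * ι F.0# ≈ 1# + ι (F.- F.1#) * 1#
    initial₀ = begin
      √D * ι F.0#                 ≈⟨ trans (*-congˡ ι-homo-0) (zeroʳ √D) ⟩
      0#                          ≈⟨ -‿inverseʳ 1# ⟨
      1# - 1#                     ≈⟨ +-congˡ (ι-1*x≈-x 1#) ⟨
      1# + ι (F.- F.1#) * 1#      ∎
    initial₁ : √D * ι F.1# ≈ α * 1# + ι (F.- F.1#) * (β * 1#)
    initial₁ = begin
      √D * ι F.1#                        ≈⟨ trans (*-congˡ ι-homo-1) (*-identityʳ √D) ⟩
      √D                                 ≈⟨ α-β≈√D ⟨
      α - β                              ≈⟨ +-cong (*-identityʳ α) (trans (ι-1*x≈-x _) (-‿cong (*-identityʳ β))) ⟨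
      α * 1# + ι (F.- F.1#) * (β * 1#)   ∎

  private
    [x-y]+y≡x : ∀ x y → (x ℤ.- y) ℤ.+ y ≡ x
    [x-y]+y≡x = solve-∀

  A-homo-* : ∀ x y → A (x ℤ.+ y) ≈ A x * A y
  A-homo-* = powᶻ-homo-* α*α⁻¹≈1

  B-homo-* : ∀ x y → B (x ℤ.+ y) ≈ B x * B y
  B-homo-* = powᶻ-homo-* β*β⁻¹≈1

  G-one : ∀ m → G F.1# m ≈ A m + B m
  G-one m = +-congˡ (trans (*-congʳ ι-homo-1) (*-identityˡ _))

  G-addition : ∀ ε x y → G ε (x ℤ.+ y) ≈ G ε x * G F.1# y - ι (q ^ᶻ y) * G ε (x ℤ.- y)
  G-addition ε x y = sym (begin
    G ε x * G F.1# y - ι (q ^ᶻ y) * G ε (x ℤ.- y)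
      ≈⟨ +-cong (*-cong (+-cong A-split (*-congˡ B-split)) (sym (G-one y))) (-‿cong (*-congʳ (A*B≈ιq^ᶻ y))) ⟨
    (a' * a + e * (b' * b)) * (a + b) - a * b * (a' + e * b')
      ≈⟨ solve 5 (λ e a b a' b' → (a' :* a :+ e :* (b' :* b)) :* (a :+ b) :- a :* b :* (a' :+ e :* b')
                               := a' :* a :* a :+ e :* (b' :* b :* b)) refl e a b a' b' ⟩
    a' * a * a + e * (b' * b * b)
      ≈⟨ +-cong (*-congʳ A-split) (*-congˡ (*-congʳ B-split)) ⟩
    A x * a + e * (B x * b)
      ≈⟨ +-cong (A-homo-* x y) (*-congˡ (B-homo-* x y)) ⟨
    G ε (x ℤ.+ y) ∎)
    where
    e = ι ε
    a = A y
    b = B y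
    a' = A (x ℤ.- y)
    b' = B (x ℤ.- y)
    x-y+y≡x : (x ℤ.- y) ℤ.+ y ≡ x
    x-y+y≡x = [x-y]+y≡x x y
    A-split : a' * a ≈ A x
    A-split = trans (sym (A-homo-* (x ℤ.- y) y)) (reflexive (≡.cong A x-y+y≡x))
    B-split : b' * b ≈ B x
    B-split = trans (sym (B-homo-* (x ℤ.- y) y)) (reflexive (≡.cong B x-y+y≡x))

  split-power : ∀ {x x'} (x*x'≈1 : x * x' ≈ 1#) {N k} → k ℕ.≤ N → ∀ m →
                powᶻ x x' m ^ (N ∸ k) ≈ powᶻ x x' (m ℤ.* N-2i N k) * powᶻ x x' m ^ k
  split-power {x} {x'} x*x'≈1 {N} {k} k≤N m = begin
    powᶻ x x' m ^ (N ∸ k)                                  ≈⟨ powᶻ-assocʳ x*x'≈1 m (N ∸ k) ⟩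
    powᶻ x x' (m ℤ.* + (N ∸ k))                            ≡⟨ ≡.cong (powᶻ x x') (m[N∸i]≡m[N-2i]+mi k≤N m) ⟩
    powᶻ x x' (m ℤ.* N-2i N k ℤ.+ m ℤ.* + k)               ≈⟨ powᶻ-homo-* x*x'≈1 (m ℤ.* N-2i N k) (m ℤ.* + k) ⟩
    powᶻ x x' (m ℤ.* N-2i N k) * powᶻ x x' (m ℤ.* + k)     ≈⟨ *-congˡ (powᶻ-assocʳ x*x'≈1 m k) ⟨
    powᶻ x x' (m ℤ.* N-2i N k) * powᶻ x x' m ^ k           ∎

  module _ {ε : F.Carrier} (ε*ε≈1 : ε F.* ε F.≈ F.1#) where

    private
      e = ι ε
      e*e≈1 : e * e ≈ 1#
      e*e≈1 = trans (sym (ι-homo-* ε ε)) (trans (ι-cong ε*ε≈1) ι-homo-1)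

      e^k*e^k≈1 : ∀ k → e ^ k * e ^ k ≈ 1#
      e^k*e^k≈1 zero    = *-identityˡ 1#
      e^k*e^k≈1 (suc k) = begin
        e * e ^ k * (e * e ^ k)       ≈⟨ solve 2 (λ e a → e :* a :* (e :* a) := e :* e :* (a :* a)) refl e (e ^ k) ⟩
        e * e * (e ^ k * e ^ k)       ≈⟨ *-cong e*e≈1 (e^k*e^k≈1 k) ⟩
        1# * 1#                       ≈⟨ *-identityˡ 1# ⟩
        1#                            ∎

      e^[N∸k]≈e^N*e^k : ∀ {N k} → k ℕ.≤ N → e ^ (N ∸ k) ≈ e ^ N * e ^ k
      e^[N∸k]≈e^N*e^k {N} {k} k≤N = sym (begin
        e ^ N * e ^ k                      ≡⟨ ≡.cong (λ n → e ^ n * e ^ k) (ℕ.m∸n+n≡m k≤N) ⟨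
        e ^ (N ∸ k ℕ.+ k) * e ^ k          ≈⟨ *-congʳ (^-homo-* e (N ∸ k) k) ⟩
        e ^ (N ∸ k) * e ^ k * e ^ k        ≈⟨ *-assoc _ _ _ ⟩
        e ^ (N ∸ k) * (e ^ k * e ^ k)      ≈⟨ *-congˡ (e^k*e^k≈1 k) ⟩
        e ^ (N ∸ k) * 1#                   ≈⟨ *-identityʳ _ ⟩
        e ^ (N ∸ k)                        ∎)

    G-reflection : ∀ x → G ε (ℤ.- x) * ι (q ^ᶻ x) ≈ e * G ε x
    G-reflection x = begin
      G ε (ℤ.- x) * ι (q ^ᶻ x)                       ≈⟨ *-congˡ (A*B≈ιq^ᶻ x) ⟨
      (A (ℤ.- x) + e * B (ℤ.- x)) * (A x * B x)      ≈⟨ solve 5 (λ e a b a' b' → (a' :+ e :* b') :* (a :* b) := a' :* a :* b :+ e :* (b' :* b :* a)) refl e (A x) (B x) _ _ ⟩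
      A (ℤ.- x) * A x * B x + e * (B (ℤ.- x) * B x * A x)
                                                     ≈⟨ +-cong (*-congʳ (powᶻ-inverseˡ α*α⁻¹≈1 x)) (*-congˡ (*-congʳ (powᶻ-inverseˡ β*β⁻¹≈1 x))) ⟩
      1# * B x + e * (1# * A x)                      ≈⟨ +-cong (*-congʳ e*e≈1) (*-congˡ (sym (*-identityˡ (A x)))) ⟨
      e * e * B x + e * A x                          ≈⟨ solve 3 (λ e a b → e :* e :* b :+ e :* a := e :* (a :+ e :* b)) refl e (A x) (B x) ⟩
      e * G ε x                                      ∎

    binomial-term : ∀ {N k} → k ℕ.≤ N → ∀ m →
      A m ^ (N ∸ k) * (e * B m) ^ k + (e * B m) ^ (N ∸ k) * A m ^ k
        ≈ ι (ε ^ⁿ k) * ι (q ^ᶻ (m ℤ.* + k)) * G (ε ^ⁿ N) (m ℤ.* N-2i N k)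
    binomial-term {N} {k} k≤N m = begin
      a ^ (N ∸ k) * (e * b) ^ k + (e * b) ^ (N ∸ k) * a ^ k
        ≈⟨ +-cong (*-congˡ (^-distrib-* e b k)) (*-congʳ (trans (^-distrib-* e b (N ∸ k)) (*-congʳ (e^[N∸k]≈e^N*e^k k≤N)))) ⟩
      a ^ (N ∸ k) * (e ^ k * b ^ k) + e ^ N * e ^ k * b ^ (N ∸ k) * a ^ k
        ≈⟨ +-cong (*-congʳ (split-power α*α⁻¹≈1 k≤N m)) (*-congʳ (*-congˡ (split-power β*β⁻¹≈1 k≤N m))) ⟩
      A mc * a ^ k * (e ^ k * b ^ k) + e ^ N * e ^ k * (B mc * b ^ k) * a ^ k
        ≈⟨ solve 6 (λ A' B' x y eᵏ eᴺ → A' :* x :* (eᵏ :* y) :+ eᴺ :* eᵏ :* (B' :* y) :* x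
                                       := eᵏ :* (x :* y) :* (A' :+ eᴺ :* B')) refl (A mc) (B mc) (a ^ k) (b ^ k) (e ^ k) (e ^ N) ⟩
      e ^ k * (a ^ k * b ^ k) * (A mc + e ^ N * B mc)
        ≈⟨ *-cong (*-cong (sym (ι-homo-^ⁿ ε k)) qᵐᵏ) (+-congˡ (*-congʳ (sym (ι-homo-^ⁿ ε N)))) ⟩
      ι (ε ^ⁿ k) * ι (q ^ᶻ (m ℤ.* + k)) * G (ε ^ⁿ N) mc
        ∎
      where
      a = A m
      b = B m
      mc = m ℤ.* N-2i N k
      qᵐᵏ : a ^ k * b ^ k ≈ ι (q ^ᶻ (m ℤ.* + k))
      qᵐᵏ = trans (*-cong (powᶻ-assocʳ α*α⁻¹≈1 m k) (powᶻ-assocʳ β*β⁻¹≈1 m k)) (A*B≈ιq^ᶻ (m ℤ.* + k))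

    G-power-expansion : ∀ N m → G ε m ^ N + G ε m ^ N ≈
      ∑[ k ≤ N ] ((N C toℕ k) × (ι (ε ^ⁿ toℕ k) * ι (q ^ᶻ (m ℤ.* + toℕ k)) * G (ε ^ⁿ N) (m ℤ.* N-2i N (toℕ k))))
    G-power-expansion N m = begin
      G ε m ^ N + G ε m ^ N
        ≈⟨ +-congˡ (^-congˡ N (+-comm _ _)) ⟩
      (A m + e * B m) ^ N + (e * B m + A m) ^ N
        ≈⟨ binomial-symmetric N (A m) (e * B m) ⟩
      ∑[ k ≤ N ] ((N C toℕ k) × (A m ^ (N ∸ toℕ k) * (e * B m) ^ toℕ k + (e * B m) ^ (N ∸ toℕ k) * A m ^ toℕ k))
        ≈⟨ sum-cong-≋ {suc N} (λ k → ×-congʳ (N C toℕ k) (binomial-term (ℕ.≤-pred (toℕ<n k)) m)) ⟩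
      ∑[ k ≤ N ] ((N C toℕ k) × (ι (ε ^ⁿ toℕ k) * ι (q ^ᶻ (m ℤ.* + toℕ k)) * G (ε ^ⁿ N) (m ℤ.* N-2i N (toℕ k))))
        ∎

  ι-Σ : ∀ N f → ι (Σ[0… N ] f) ≈ ∑[ k ≤ N ] ι (f (toℕ k))
  ι-Σ zero    f = sym (+-identityʳ _)
  ι-Σ (suc N) f = begin
    ι (Σ[0… N ] f F.+ f (suc N))                                     ≈⟨ ι-homo-+ _ _ ⟩
    ι (Σ[0… N ] f) + ι (f (suc N))                                   ≈⟨ +-congʳ (ι-Σ N f) ⟩
    ∑[ k ≤ N ] ι (f (toℕ k)) + ι (f (suc N))                         ≈⟨ +-cong (sum-cong-≋ {suc N} (λ k → reflexive (≡.cong (ι ∘ f) (toℕ-inject₁ k)))) (reflexive (≡.cong (ι ∘ f) (toℕ-fromℕ (suc N)))) ⟨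
    ∑[ k ≤ N ] ι (f (toℕ (inject₁ k))) + ι (f (toℕ (Fin.fromℕ (suc N)))) ≈⟨ sum-init-last (λ k → ι (f (toℕ k))) ⟨
    ∑[ k ≤ suc N ] ι (f (toℕ k))                                     ∎

  ×-as-ι-fromℕ : ∀ n x → n × x ≈ ι (fromℕ n) * x
  ×-as-ι-fromℕ n x = sym (trans (*-congʳ (ι-homo-fromℕ n)) (trans (×-assoc-* n 1# x) (×-congʳ n (*-identityˡ x))))

  Cancellative : Carrier → Set (c ⊔ ℓ)
  Cancellative w = ∀ {a b} → w * ι a ≈ w * ι b → a F.≈ b

  1-cancellative : Cancellative 1#
  1-cancellative e = ι-injective (trans (sym (*-identityˡ _)) (trans e (*-identityˡ _)))

  √D-cancellative : Cancellative √D
  √D-cancellative e = ι-*√D-injective (trans (*-comm _ _) (trans e (*-comm _ _)))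

  ι-homo-ab-cd : ∀ a b c d → ι (a F.* b F.- c F.* d) ≈ ι a * ι b - ι c * ι d
  ι-homo-ab-cd a b c d = trans (ι-homo-- _ _) (+-cong (ι-homo-* a b) (-‿cong (ι-homo-* c d)))

  module _ {ε w g} (g-rep : Represents ε w g) (w-cancel : Cancellative w) where

    addition : ∀ x y → g (x ℤ.+ y) F.≈ g x F.* v y F.- q ^ᶻ y F.* g (x ℤ.- y)
    addition x y = w-cancel (begin
      w * ι (g (x ℤ.+ y))                                              ≈⟨ g-rep (x ℤ.+ y) ⟩
      G ε (x ℤ.+ y)                                                    ≈⟨ G-addition ε x y ⟩
      G ε x * G F.1# y - ι (q ^ᶻ y) * G ε (x ℤ.- y)                    ≈⟨ +-cong (*-cong (g-rep x) (trans (sym (*-identityˡ _)) (v-binet y))) (-‿cong (*-congˡ (g-rep (x ℤ.- y)))) ⟨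
      w * ι (g x) * ι (v y) - ι (q ^ᶻ y) * (w * ι (g (x ℤ.- y)))
        ≈⟨ solve 5 (λ w a b c d → w :* a :* b :- c :* (w :* d) := w :* (a :* b :- c :* d)) refl w _ _ _ _ ⟩
      w * (ι (g x) * ι (v y) - ι (q ^ᶻ y) * ι (g (x ℤ.- y)))          ≈⟨ *-congˡ (ι-homo-ab-cd _ _ _ _) ⟨
      w * ι (g x F.* v y F.- q ^ᶻ y F.* g (x ℤ.- y))                   ∎)

    reflection : ε F.* ε F.≈ F.1# → ∀ x → g (ℤ.- x) F.* q ^ᶻ x F.≈ ε F.* g x
    reflection ε*ε≈1 x = w-cancel (begin
      w * ι (g (ℤ.- x) F.* q ^ᶻ x)             ≈⟨ *-congˡ (ι-homo-* _ _) ⟩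
      w * (ι (g (ℤ.- x)) * ι (q ^ᶻ x))         ≈⟨ *-assoc _ _ _ ⟨
      w * ι (g (ℤ.- x)) * ι (q ^ᶻ x)           ≈⟨ *-congʳ (g-rep (ℤ.- x)) ⟩
      G ε (ℤ.- x) * ι (q ^ᶻ x)                 ≈⟨ G-reflection ε*ε≈1 x ⟩
      ι ε * G ε x                              ≈⟨ *-congˡ (g-rep x) ⟨
      ι ε * (w * ι (g x))                      ≈⟨ x∙yz≈y∙xz _ _ _ ⟩
      w * (ι ε * ι (g x))                      ≈⟨ *-congˡ (ι-homo-* _ _) ⟨
      w * ι (ε F.* g x)                        ∎)
      where open import Algebra.Properties.CommutativeSemigroup *-commutativeSemigroup using (x∙yz≈y∙xz)

  power-expansion : ∀ {ε ε' w w' h g} → ε F.* ε F.≈ F.1# → Represents ε w h → Represents ε' w' g → Cancellative w' →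
    ∀ N K → ε ^ⁿ N F.≈ ε' → w ^ N ≈ w' * ι K → ∀ m →
    fromℕ 2 F.* K F.* h m ^ⁿ N F.≈ Σ[0… N ] (λ i → ε ^ⁿ i F.* fromℕ (N C i) F.* q ^ᶻ (m ℤ.* + i) F.* g (m ℤ.* N-2i N i))
  power-expansion {ε} {ε'} {w} {w'} {h} {g} ε*ε≈1 h-rep g-rep w'-cancel N K εᴺ≈ε' wᴺ≈w'K m = w'-cancel (begin
    w' * ι (fromℕ 2 F.* K F.* h m ^ⁿ N)
      ≈⟨ *-congˡ (trans (ι-homo-* _ _) (*-cong (ι-homo-* _ _) (ι-homo-^ⁿ (h m) N))) ⟩
    w' * (ι (fromℕ 2) * ι K * ι (h m) ^ N)
      ≈⟨ solve 4 (λ w' t k x → w' :* (t :* k :* x) := w' :* k :* x :* t) refl w' _ _ _ ⟩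
    w' * ι K * ι (h m) ^ N * ι (fromℕ 2)
      ≈⟨ *-cong (trans (*-congʳ (sym wᴺ≈w'K)) (sym (^-distrib-* w (ι (h m)) N))) (ι-homo-fromℕ 2) ⟩
    (w * ι (h m)) ^ N * (2 × 1#)
      ≈⟨ *-congʳ (^-congˡ N (h-rep m)) ⟩
    G ε m ^ N * (2 × 1#)
      ≈⟨ solve 1 (λ x → x :* con (+ 2) := x :+ x) refl _ ⟩
    G ε m ^ N + G ε m ^ N
      ≈⟨ G-power-expansion ε*ε≈1 N m ⟩
    ∑[ k ≤ N ] ((N C toℕ k) × (ι (ε ^ⁿ toℕ k) * ι (q ^ᶻ (m ℤ.* + toℕ k)) * G (ε ^ⁿ N) (m ℤ.* N-2i N (toℕ k))))
      ≈⟨ sum-cong-≋ {suc N} (λ k → term (toℕ k)) ⟩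
    ∑[ k ≤ N ] (w' * ι (t (toℕ k)))
      ≈⟨ *-distribˡ-sum {suc N} w' (λ k → ι (t (toℕ k))) ⟨
    w' * ∑[ k ≤ N ] ι (t (toℕ k))
      ≈⟨ *-congˡ (ι-Σ N t) ⟨
    w' * ι (Σ[0… N ] t) ∎)
    where
    t : ℕ → F.Carrier
    t i = ε ^ⁿ i F.* fromℕ (N C i) F.* q ^ᶻ (m ℤ.* + i) F.* g (m ℤ.* N-2i N i)
    term : ∀ i → (N C i) × (ι (ε ^ⁿ i) * ι (q ^ᶻ (m ℤ.* + i)) * G (ε ^ⁿ N) (m ℤ.* N-2i N i)) ≈ w' * ι (t i)
    term i = begin
      (N C i) × (ι (ε ^ⁿ i) * ι (q ^ᶻ (m ℤ.* + i)) * G (ε ^ⁿ N) (m ℤ.* N-2i N i))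
        ≈⟨ ×-as-ι-fromℕ (N C i) _ ⟩
      ι (fromℕ (N C i)) * (ι (ε ^ⁿ i) * ι (q ^ᶻ (m ℤ.* + i)) * G (ε ^ⁿ N) (m ℤ.* N-2i N i))
        ≈⟨ *-congˡ (*-congˡ (trans (+-congˡ (*-congʳ (ι-cong εᴺ≈ε'))) (sym (g-rep _)))) ⟩
      ι (fromℕ (N C i)) * (ι (ε ^ⁿ i) * ι (q ^ᶻ (m ℤ.* + i)) * (w' * ι (g (m ℤ.* N-2i N i))))
        ≈⟨ solve 5 (λ c s r w' x → c :* (s :* r :* (w' :* x)) := w' :* (s :* c :* r :* x)) refl _ _ _ w' _ ⟩
      w' * (ι (ε ^ⁿ i) * ι (fromℕ (N C i)) * ι (q ^ᶻ (m ℤ.* + i)) * ι (g (m ℤ.* N-2i N i)))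
        ≈⟨ *-congˡ (trans (ι-homo-* _ _) (*-congʳ (trans (ι-homo-* _ _) (*-congʳ (ι-homo-* _ _))))) ⟨
      w' * ι (t i) ∎

  private
    -1*-1≈1 : F.- F.1# F.* F.- F.1# F.≈ F.1#
    -1*-1≈1 = F.trans (F.-1*x≈-x (F.- F.1#)) (F.-‿involutive F.1#)

  v-addition : ∀ x y → v (x ℤ.+ y) F.≈ v x F.* v y F.- q ^ᶻ y F.* v (x ℤ.- y)
  v-addition = addition v-binet 1-cancellative

  u-addition : ∀ x y → u (x ℤ.+ y) F.≈ u x F.* v y F.- q ^ᶻ y F.* u (x ℤ.- y)
  u-addition = addition u-binet √D-cancellative

  v-reflection : ∀ x → v (ℤ.- x) F.* q ^ᶻ x F.≈ F.1# F.* v x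
  v-reflection = reflection v-binet 1-cancellative (F.*-identityˡ F.1#)

  u-reflection : ∀ x → u (ℤ.- x) F.* q ^ᶻ x F.≈ F.- F.1# F.* u x
  u-reflection = reflection u-binet √D-cancellative -1*-1≈1

  private
    1^N≈1*ι1 : ∀ N → 1# ^ N ≈ 1# * ι F.1#
    1^N≈1*ι1 N = trans (^-assocʳ 1# 0 N) (sym (trans (*-identityˡ _) ι-homo-1))

    √D^[2n]≈ιDⁿ : ∀ n → √D ^ (2 ℕ.* n) ≈ ι (D ^ⁿ n)
    √D^[2n]≈ιDⁿ n = begin
      √D ^ (2 ℕ.* n)     ≈⟨ ^-assocʳ √D 2 n ⟨
      (√D ^ 2) ^ n       ≈⟨ ^-congˡ n (trans (*-congˡ (*-identityʳ √D)) √D*√D≈ιD) ⟩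
      ι D ^ n            ≈⟨ ι-homo-^ⁿ D n ⟨
      ι (D ^ⁿ n)         ∎

  v-power-expansion : ∀ N m → fromℕ 2 F.* v m ^ⁿ N F.≈
    Σ[0… N ] (λ i → fromℕ (N C i) F.* q ^ᶻ (m ℤ.* + i) F.* v (m ℤ.* N-2i N i))
  v-power-expansion N m = F.trans (F.*-congʳ (F.sym (F.*-identityʳ _)))
    (F.trans (power-expansion (F.*-identityˡ F.1#) v-binet v-binet 1-cancellative N F.1# (1^ⁿn≈1 N) (1^N≈1*ι1 N) m)
             (Σ-cong N (λ i _ → F.*-congʳ (F.*-congʳ (F.trans (F.*-congʳ (1^ⁿn≈1 i)) (F.*-identityˡ _))))))

  u-even-power-expansion : ∀ n m → fromℕ 2 F.* D ^ⁿ n F.* u m ^ⁿ (2 ℕ.* n) F.≈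
    Σ[0… 2 ℕ.* n ] (λ i → sgn i F.* fromℕ ((2 ℕ.* n) C i) F.* q ^ᶻ (m ℤ.* + i) F.* v (m ℤ.* N-2i (2 ℕ.* n) i))
  u-even-power-expansion n = power-expansion -1*-1≈1 u-binet v-binet 1-cancellative (2 ℕ.* n) (D ^ⁿ n)
    (-1^ⁿ[2n]≈1 n) (trans (√D^[2n]≈ιDⁿ n) (sym (*-identityˡ _)))

  u-odd-power-expansion : ∀ n → 1 ℕ.≤ n → ∀ m → fromℕ 2 F.* D ^ⁿ (n ∸ 1) F.* u m ^ⁿ (2 ℕ.* n ∸ 1) F.≈
    Σ[0… 2 ℕ.* n ∸ 1 ] (λ i → sgn i F.* fromℕ ((2 ℕ.* n ∸ 1) C i) F.* q ^ᶻ (m ℤ.* + i) F.* u (m ℤ.* N-2i (2 ℕ.* n ∸ 1) i))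
  u-odd-power-expansion (suc n) _ = power-expansion -1*-1≈1 u-binet u-binet √D-cancellative (2 ℕ.* suc n ∸ 1) (D ^ⁿ n)
    (F.trans (F.reflexive (≡.cong ((F.- F.1#) ^ⁿ_) 2[1+n]∸1≡1+2n)) (-1^ⁿ[1+2n]≈-1 n))
    (begin
      √D ^ (2 ℕ.* suc n ∸ 1)      ≡⟨ ≡.cong (√D ^_) 2[1+n]∸1≡1+2n ⟩
      √D * √D ^ (2 ℕ.* n)         ≈⟨ *-congˡ (√D^[2n]≈ιDⁿ n) ⟩
      √D * ι (D ^ⁿ n)             ∎)
    where
    2[1+n]∸1≡1+2n : 2 ℕ.* suc n ∸ 1 ≡ suc (2 ℕ.* n)
    2[1+n]∸1≡1+2n = ℕ.+-suc n (1 ℕ.* n)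

module LucasGeneratingFunctions {c ℓ} (F : Field c ℓ) (p q : Field.Carrier F) (q≉0 : ¬ (Field._≈_ F q (Field.0# F))) where
  open Field F hiding (zero)
  open FieldOps F
  open Lucas F p q
  open FieldProperties F using (^ᶻ-homo-*; ÷-unique; Σ-cong; Σᶻ-cong; Σ-distrib--; Σ-neg; *-distribˡ-Σ; *-distribˡ-Σᶻ; Σᶻ-comm-Σ)
  open IntegerCoefficientSolver commutativeRing using (solve; _:+_; _:*_; _:-_; :-_; _:=_)
  open import Algebra.Properties.Ring ring using (-1*x≈-x)
  open import Relation.Binary.Reasoning.Setoid setoid

  open Telescoping F using (module ForRecurrence)

  module GeneratingFunction (g : ℤ → Carrier) (ε : Carrier)
    (g-addition : ∀ x y → g (x ℤ.+ y) ≈ g x * v y - q ^ᶻ y * g (x ℤ.- y))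
    (g-reflection : ∀ x → g (ℤ.- x) * q ^ᶻ x ≈ ε * g x)
    (N : ℕ) (r s e : ℤ) (e≡rN : e ≡ r ℤ.* + N) where

    private
      q^-homo : ∀ a b → q ^ᶻ (a ℤ.+ b) ≈ q ^ᶻ a * q ^ᶻ b
      q^-homo = ^ᶻ-homo-* q≉0

    weight : ℕ → ℤ → Carrier
    weight i j = q ^ᶻ ((r ℤ.* j ℤ.+ s) ℤ.* + i) * g ((r ℤ.* j ℤ.+ s) ℤ.* N-2i N i)

    weight-rec : ∀ i j → weight i (ℤ.suc j) ≈ q ^ᶻ (r ℤ.* + i) * v (r ℤ.* N-2i N i) * weight i j - q ^ᶻ e * weight i (ℤ.pred j)
    weight-rec i j = begin
      q ^ᶻ ((r ℤ.* (+ 1 ℤ.+ j) ℤ.+ s) ℤ.* + i) * g ((r ℤ.* (+ 1 ℤ.+ j) ℤ.+ s) ℤ.* cᵢ)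
        ≡⟨ ≡.cong₂ (λ a b → q ^ᶻ a * g b) (expand₁ r j s (+ i)) (expand₂ r j s cᵢ) ⟩
      q ^ᶻ (r ℤ.* + i ℤ.+ m ℤ.* + i) * g (m ℤ.* cᵢ ℤ.+ r ℤ.* cᵢ)
        ≈⟨ *-cong (q^-homo (r ℤ.* + i) (m ℤ.* + i)) (g-addition (m ℤ.* cᵢ) (r ℤ.* cᵢ)) ⟩
      q ^ᶻ (r ℤ.* + i) * q ^ᶻ (m ℤ.* + i) * (g (m ℤ.* cᵢ) * v (r ℤ.* cᵢ) - q ^ᶻ (r ℤ.* cᵢ) * g (m ℤ.* cᵢ ℤ.- r ℤ.* cᵢ))
        ≡⟨ ≡.cong (λ a → q ^ᶻ (r ℤ.* + i) * q ^ᶻ (m ℤ.* + i) * (g (m ℤ.* cᵢ) * v (r ℤ.* cᵢ) - q ^ᶻ (r ℤ.* cᵢ) * g a)) (expand₃ r j s cᵢ) ⟩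
      q ^ᶻ (r ℤ.* + i) * q ^ᶻ (m ℤ.* + i) * (g (m ℤ.* cᵢ) * v (r ℤ.* cᵢ) - q ^ᶻ (r ℤ.* cᵢ) * g (m' ℤ.* cᵢ))
        ≈⟨ solve 6 (λ a b x y d z → a :* b :* (x :* y :- d :* z) := a :* y :* (b :* x) :- a :* b :* d :* z) refl _ _ _ _ _ _ ⟩
      q ^ᶻ (r ℤ.* + i) * v (r ℤ.* cᵢ) * weight i j - q ^ᶻ (r ℤ.* + i) * q ^ᶻ (m ℤ.* + i) * q ^ᶻ (r ℤ.* cᵢ) * g (m' ℤ.* cᵢ)
        ≈⟨ +-congˡ (-‿cong (sym lower-weight)) ⟩
      q ^ᶻ (r ℤ.* + i) * v (r ℤ.* cᵢ) * weight i j - q ^ᶻ e * weight i (ℤ.pred j) ∎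
      where
      cᵢ = N-2i N i
      m = r ℤ.* j ℤ.+ s
      m' = r ℤ.* (ℤ.-1ℤ ℤ.+ j) ℤ.+ s
      expand₁ : ∀ r j s i → (r ℤ.* (+ 1 ℤ.+ j) ℤ.+ s) ℤ.* i ≡ r ℤ.* i ℤ.+ (r ℤ.* j ℤ.+ s) ℤ.* i
      expand₁ = solve-∀
      expand₂ : ∀ r j s cᵢ → (r ℤ.* (+ 1 ℤ.+ j) ℤ.+ s) ℤ.* cᵢ ≡ (r ℤ.* j ℤ.+ s) ℤ.* cᵢ ℤ.+ r ℤ.* cᵢ
      expand₂ = solve-∀
      expand₃ : ∀ r j s cᵢ → (r ℤ.* j ℤ.+ s) ℤ.* cᵢ ℤ.- r ℤ.* cᵢ ≡ (r ℤ.* (ℤ.-1ℤ ℤ.+ j) ℤ.+ s) ℤ.* cᵢ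
      expand₃ = solve-∀
      expand₄ : ∀ r j s N i → r ℤ.* N ℤ.+ (r ℤ.* (ℤ.-1ℤ ℤ.+ j) ℤ.+ s) ℤ.* i ≡ (r ℤ.* i ℤ.+ (r ℤ.* j ℤ.+ s) ℤ.* i) ℤ.+ r ℤ.* (N ℤ.- + 2 ℤ.* i)
      expand₄ = solve-∀
      lower-weight : q ^ᶻ e * weight i (ℤ.pred j) ≈ q ^ᶻ (r ℤ.* + i) * q ^ᶻ (m ℤ.* + i) * q ^ᶻ (r ℤ.* cᵢ) * g (m' ℤ.* cᵢ)
      lower-weight = begin
        q ^ᶻ e * (q ^ᶻ (m' ℤ.* + i) * g (m' ℤ.* cᵢ))                     ≈⟨ *-assoc _ _ _ ⟨
        q ^ᶻ e * q ^ᶻ (m' ℤ.* + i) * g (m' ℤ.* cᵢ)                       ≈⟨ *-congʳ (q^-homo e (m' ℤ.* + i)) ⟨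
        q ^ᶻ (e ℤ.+ m' ℤ.* + i) * g (m' ℤ.* cᵢ)                          ≡⟨ ≡.cong (λ a → q ^ᶻ (a ℤ.+ m' ℤ.* + i) * g (m' ℤ.* cᵢ)) e≡rN ⟩
        q ^ᶻ (r ℤ.* + N ℤ.+ m' ℤ.* + i) * g (m' ℤ.* cᵢ)                  ≡⟨ ≡.cong (λ a → q ^ᶻ a * g (m' ℤ.* cᵢ)) (expand₄ r j s (+ N) (+ i)) ⟩
        q ^ᶻ (r ℤ.* + i ℤ.+ m ℤ.* + i ℤ.+ r ℤ.* cᵢ) * g (m' ℤ.* cᵢ)       ≈⟨ *-congʳ (trans (q^-homo (r ℤ.* + i ℤ.+ m ℤ.* + i) (r ℤ.* cᵢ)) (*-congʳ (q^-homo (r ℤ.* + i) (m ℤ.* + i)))) ⟩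
        q ^ᶻ (r ℤ.* + i) * q ^ᶻ (m ℤ.* + i) * q ^ᶻ (r ℤ.* cᵢ) * g (m' ℤ.* cᵢ) ∎

    module _ (i : ℕ) (z : Carrier) where
      open ForRecurrence (q ^ᶻ (r ℤ.* + i) * v (r ℤ.* N-2i N i)) (q ^ᶻ e) (weight i) (weight-rec i) z public

    upper : ℕ → ℤ → Carrier → Carrier
    upper i k z = q ^ᶻ (r ℤ.* (+ N ℤ.+ k ℤ.* + i)) * g ((r ℤ.* k ℤ.+ s) ℤ.* N-2i N i) * z ^ᶻ (k ℤ.+ + 2)
                - q ^ᶻ (r ℤ.* + i ℤ.* (k ℤ.+ + 1)) * g ((r ℤ.* k ℤ.+ r ℤ.+ s) ℤ.* N-2i N i) * z ^ᶻ (k ℤ.+ + 1)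

    reflected : ℕ → Carrier → Carrier
    reflected i z = q ^ᶻ (s ℤ.* N-2i N i ℤ.+ r ℤ.* + i) * g ((r ℤ.- s) ℤ.* N-2i N i) * z

    lower : ℕ → Carrier → Carrier
    lower i z = ε * reflected i z - g (s ℤ.* N-2i N i)

    boundary-upper : ∀ i k z → boundary i z k ≈ q ^ᶻ (s ℤ.* + i) * upper i k z
    boundary-upper i k z = begin
      q ^ᶻ e * weight i k * z ^ᶻ (k ℤ.+ + 2) - weight i (ℤ.suc k) * z ^ᶻ (k ℤ.+ + 1)
        ≈⟨ +-cong (*-congʳ first) (-‿cong (*-congʳ second)) ⟩
      q ^ᶻ (s ℤ.* + i) * q ^ᶻ (r ℤ.* (+ N ℤ.+ k ℤ.* + i)) * g (mₖ ℤ.* cᵢ) * z ^ᶻ (k ℤ.+ + 2)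
        - q ^ᶻ (s ℤ.* + i) * q ^ᶻ (r ℤ.* + i ℤ.* (k ℤ.+ + 1)) * g ((r ℤ.* k ℤ.+ r ℤ.+ s) ℤ.* cᵢ) * z ^ᶻ (k ℤ.+ + 1)
        ≈⟨ solve 7 (λ a b x y b' x' y' → a :* b :* x :* y :- a :* b' :* x' :* y' := a :* (b :* x :* y :- b' :* x' :* y')) refl _ _ _ _ _ _ _ ⟩
      q ^ᶻ (s ℤ.* + i) * upper i k z ∎
      where
      cᵢ = N-2i N i
      mₖ = r ℤ.* k ℤ.+ s
      expand₁ : ∀ r k s N i → r ℤ.* N ℤ.+ (r ℤ.* k ℤ.+ s) ℤ.* i ≡ s ℤ.* i ℤ.+ r ℤ.* (N ℤ.+ k ℤ.* i)
      expand₁ = solve-∀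
      expand₂ : ∀ r k s i → (r ℤ.* (+ 1 ℤ.+ k) ℤ.+ s) ℤ.* i ≡ s ℤ.* i ℤ.+ r ℤ.* i ℤ.* (k ℤ.+ + 1)
      expand₂ = solve-∀
      expand₃ : ∀ r k s c → (r ℤ.* (+ 1 ℤ.+ k) ℤ.+ s) ℤ.* c ≡ (r ℤ.* k ℤ.+ r ℤ.+ s) ℤ.* c
      expand₃ = solve-∀
      first : q ^ᶻ e * weight i k ≈ q ^ᶻ (s ℤ.* + i) * q ^ᶻ (r ℤ.* (+ N ℤ.+ k ℤ.* + i)) * g (mₖ ℤ.* cᵢ)
      first = begin
        q ^ᶻ e * (q ^ᶻ (mₖ ℤ.* + i) * g (mₖ ℤ.* cᵢ))               ≈⟨ *-assoc _ _ _ ⟨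
        q ^ᶻ e * q ^ᶻ (mₖ ℤ.* + i) * g (mₖ ℤ.* cᵢ)                 ≈⟨ *-congʳ (q^-homo e (mₖ ℤ.* + i)) ⟨
        q ^ᶻ (e ℤ.+ mₖ ℤ.* + i) * g (mₖ ℤ.* cᵢ)                    ≡⟨ ≡.cong (λ a → q ^ᶻ a * g (mₖ ℤ.* cᵢ)) (≡.trans (≡.cong (ℤ._+ mₖ ℤ.* + i) e≡rN) (expand₁ r k s (+ N) (+ i))) ⟩
        q ^ᶻ (s ℤ.* + i ℤ.+ r ℤ.* (+ N ℤ.+ k ℤ.* + i)) * g (mₖ ℤ.* cᵢ) ≈⟨ *-congʳ (q^-homo (s ℤ.* + i) _) ⟩
        q ^ᶻ (s ℤ.* + i) * q ^ᶻ (r ℤ.* (+ N ℤ.+ k ℤ.* + i)) * g (mₖ ℤ.* cᵢ) ∎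
      second : weight i (ℤ.suc k) ≈ q ^ᶻ (s ℤ.* + i) * q ^ᶻ (r ℤ.* + i ℤ.* (k ℤ.+ + 1)) * g ((r ℤ.* k ℤ.+ r ℤ.+ s) ℤ.* cᵢ)
      second = begin
        q ^ᶻ ((r ℤ.* (+ 1 ℤ.+ k) ℤ.+ s) ℤ.* + i) * g ((r ℤ.* (+ 1 ℤ.+ k) ℤ.+ s) ℤ.* cᵢ)
          ≡⟨ ≡.cong₂ (λ a b → q ^ᶻ a * g b) (expand₂ r k s (+ i)) (expand₃ r k s cᵢ) ⟩
        q ^ᶻ (s ℤ.* + i ℤ.+ r ℤ.* + i ℤ.* (k ℤ.+ + 1)) * g ((r ℤ.* k ℤ.+ r ℤ.+ s) ℤ.* cᵢ)
          ≈⟨ *-congʳ (q^-homo (s ℤ.* + i) _) ⟩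
        q ^ᶻ (s ℤ.* + i) * q ^ᶻ (r ℤ.* + i ℤ.* (k ℤ.+ + 1)) * g ((r ℤ.* k ℤ.+ r ℤ.+ s) ℤ.* cᵢ) ∎

    g-reflection′ : ∀ x → g (ℤ.- x) ≈ ε * g x * q ^ᶻ (ℤ.- x)
    g-reflection′ x = begin
      g (ℤ.- x)                                ≈⟨ *-identityʳ _ ⟨
      g (ℤ.- x) * 1#                           ≈⟨ *-congˡ (trans (sym (q^-homo x (ℤ.- x))) (reflexive (≡.cong (q ^ᶻ_) (ℤ.+-inverseʳ x)))) ⟨
      g (ℤ.- x) * (q ^ᶻ x * q ^ᶻ (ℤ.- x))      ≈⟨ *-assoc _ _ _ ⟨
      g (ℤ.- x) * q ^ᶻ x * q ^ᶻ (ℤ.- x)        ≈⟨ *-congʳ (g-reflection x) ⟩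
      ε * g x * q ^ᶻ (ℤ.- x)                   ∎

    boundary-lower : ∀ i z → boundary i z -[1+ 0 ] ≈ q ^ᶻ (s ℤ.* + i) * lower i z
    boundary-lower i z = begin
      q ^ᶻ e * weight i -[1+ 0 ] * (z * 1#) - weight i (+ 0) * 1#
        ≈⟨ +-cong (*-cong scaled-weight₋₁ (*-identityʳ z)) (-‿cong (trans (*-identityʳ _) weight₀)) ⟩
      ε * g x * (q ^ᶻ (s ℤ.* + i) * q ^ᶻ (s ℤ.* cᵢ ℤ.+ r ℤ.* + i)) * z - q ^ᶻ (s ℤ.* + i) * g (s ℤ.* cᵢ)
        ≈⟨ solve 6 (λ ε gx a b z gs → ε :* gx :* (a :* b) :* z :- a :* gs := a :* (ε :* (b :* gx :* z) :- gs)) refl ε _ _ _ z _ ⟩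
      q ^ᶻ (s ℤ.* + i) * lower i z ∎
      where
      cᵢ = N-2i N i
      x = (r ℤ.- s) ℤ.* cᵢ
      r0+s≡s : ∀ r s → r ℤ.* + 0 ℤ.+ s ≡ s
      r0+s≡s = solve-∀
      [-r+s]c≡-[[r-s]c] : ∀ r s c → (r ℤ.* -[1+ 0 ] ℤ.+ s) ℤ.* c ≡ ℤ.- ((r ℤ.- s) ℤ.* c)
      [-r+s]c≡-[[r-s]c] = solve-∀
      expand : ∀ r s N i → (r ℤ.* N ℤ.+ (r ℤ.* -[1+ 0 ] ℤ.+ s) ℤ.* i) ℤ.+ ℤ.- ((r ℤ.- s) ℤ.* (N ℤ.- + 2 ℤ.* i))
                         ≡ s ℤ.* i ℤ.+ (s ℤ.* (N ℤ.- + 2 ℤ.* i) ℤ.+ r ℤ.* i)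
      expand = solve-∀
      weight₀ : weight i (+ 0) ≈ q ^ᶻ (s ℤ.* + i) * g (s ℤ.* cᵢ)
      weight₀ = reflexive (≡.cong (λ a → q ^ᶻ (a ℤ.* + i) * g (a ℤ.* cᵢ)) (r0+s≡s r s))
      m₋₁ = (r ℤ.* -[1+ 0 ] ℤ.+ s) ℤ.* + i
      scaled-weight₋₁ : q ^ᶻ e * weight i -[1+ 0 ] ≈ ε * g x * (q ^ᶻ (s ℤ.* + i) * q ^ᶻ (s ℤ.* cᵢ ℤ.+ r ℤ.* + i))
      scaled-weight₋₁ = begin
        q ^ᶻ e * (q ^ᶻ m₋₁ * g ((r ℤ.* -[1+ 0 ] ℤ.+ s) ℤ.* cᵢ))      ≡⟨ ≡.cong (λ a → q ^ᶻ e * (q ^ᶻ m₋₁ * g a)) ([-r+s]c≡-[[r-s]c] r s cᵢ) ⟩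
        q ^ᶻ e * (q ^ᶻ m₋₁ * g (ℤ.- x))                            ≈⟨ *-congˡ (*-congˡ (g-reflection′ x)) ⟩
        q ^ᶻ e * (q ^ᶻ m₋₁ * (ε * g x * q ^ᶻ (ℤ.- x)))             ≈⟨ solve 4 (λ a b y d → a :* (b :* (y :* d)) := y :* (a :* b :* d)) refl _ _ _ _ ⟩
        ε * g x * (q ^ᶻ e * q ^ᶻ m₋₁ * q ^ᶻ (ℤ.- x))               ≈⟨ *-congˡ (trans (q^-homo (e ℤ.+ m₋₁) (ℤ.- x)) (*-congʳ (q^-homo e m₋₁))) ⟨
        ε * g x * q ^ᶻ (e ℤ.+ m₋₁ ℤ.+ ℤ.- x)                       ≡⟨ ≡.cong (λ a → ε * g x * q ^ᶻ (a ℤ.+ m₋₁ ℤ.+ ℤ.- x)) e≡rN ⟩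
        ε * g x * q ^ᶻ (r ℤ.* + N ℤ.+ m₋₁ ℤ.+ ℤ.- x)               ≡⟨ ≡.cong (λ a → ε * g x * q ^ᶻ a) (expand r s (+ N) (+ i)) ⟩
        ε * g x * q ^ᶻ (s ℤ.* + i ℤ.+ (s ℤ.* cᵢ ℤ.+ r ℤ.* + i))    ≈⟨ *-congˡ (q^-homo (s ℤ.* + i) _) ⟩
        ε * g x * (q ^ᶻ (s ℤ.* + i) * q ^ᶻ (s ℤ.* cᵢ ℤ.+ r ℤ.* + i)) ∎

    weighted-sum : ∀ i k z → (k ℤ.< -[1+ 0 ] → ¬ (z ≈ 0#)) → ¬ (denominator i z ≈ 0#) →
      Σᶻ[0… k ] (λ j → weight i j * z ^ᶻ j)
        ≈ q ^ᶻ (s ℤ.* + i) * (upper i k z ÷ denominator i z) - q ^ᶻ (s ℤ.* + i) * (lower i z ÷ denominator i z)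
    weighted-sum i k z k<-1⇒z≉0 d≉0 = trans
      (÷-unique d≉0 (trans (telescoping i z k k<-1⇒z≉0) (+-cong (boundary-upper i k z) (-‿cong (boundary-lower i z)))))
      (solve 4 (λ a x y d → (a :* x :- a :* y) :* d := a :* (x :* d) :- a :* (y :* d)) refl _ _ _ _)

    generating-function : (K : Carrier) (h : ℤ → Carrier) (a : ℕ → Carrier) →
      (∀ m → K * h m ^ⁿ N ≈ Σ[0… N ] (λ i → a i * q ^ᶻ (m ℤ.* + i) * g (m ℤ.* N-2i N i))) →
      ∀ k z → (k ℤ.< -[1+ 0 ] → ¬ (z ≈ 0#)) → (∀ i → i ℕ.≤ N → ¬ (denominator i z ≈ 0#)) →
      K * Σᶻ[0… k ] (λ j → h (r ℤ.* j ℤ.+ s) ^ⁿ N * z ^ᶻ j)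
        ≈ Σ[0… N ] (λ i → a i * q ^ᶻ (s ℤ.* + i) * (upper i k z ÷ denominator i z))
          - Σ[0… N ] (λ i → a i * q ^ᶻ (s ℤ.* + i) * (lower i z ÷ denominator i z))
    generating-function K h a expansion k z k<-1⇒z≉0 d≉0 = begin
      K * Σᶻ[0… k ] (λ j → h (r ℤ.* j ℤ.+ s) ^ⁿ N * z ^ᶻ j)
        ≈⟨ *-distribˡ-Σᶻ k K _ ⟩
      Σᶻ[0… k ] (λ j → K * (h (r ℤ.* j ℤ.+ s) ^ⁿ N * z ^ᶻ j))
        ≈⟨ Σᶻ-cong k expand ⟩
      Σᶻ[0… k ] (λ j → Σ[0… N ] (λ i → a i * (weight i j * z ^ᶻ j)))
        ≈⟨ Σᶻ-comm-Σ k N (λ i j → a i * (weight i j * z ^ᶻ j)) ⟩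
      Σ[0… N ] (λ i → Σᶻ[0… k ] (λ j → a i * (weight i j * z ^ᶻ j)))
        ≈⟨ Σ-cong N (λ i _ → *-distribˡ-Σᶻ k (a i) _) ⟨
      Σ[0… N ] (λ i → a i * Σᶻ[0… k ] (λ j → weight i j * z ^ᶻ j))
        ≈⟨ Σ-cong N (λ i i≤N → trans (*-congˡ (weighted-sum i k z k<-1⇒z≉0 (d≉0 i i≤N)))
                                     (solve 4 (λ a b x y → a :* (b :* x :- b :* y) := a :* b :* x :- a :* b :* y) refl _ _ _ _)) ⟩
      Σ[0… N ] (λ i → a i * q ^ᶻ (s ℤ.* + i) * (upper i k z ÷ denominator i z) - a i * q ^ᶻ (s ℤ.* + i) * (lower i z ÷ denominator i z))
        ≈⟨ Σ-distrib-- N _ _ ⟩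
      Σ[0… N ] (λ i → a i * q ^ᶻ (s ℤ.* + i) * (upper i k z ÷ denominator i z))
        - Σ[0… N ] (λ i → a i * q ^ᶻ (s ℤ.* + i) * (lower i z ÷ denominator i z)) ∎
      where
      expand : ∀ j → K * (h (r ℤ.* j ℤ.+ s) ^ⁿ N * z ^ᶻ j) ≈ Σ[0… N ] (λ i → a i * (weight i j * z ^ᶻ j))
      expand j = begin
        K * (h m ^ⁿ N * z ^ᶻ j)                                                ≈⟨ *-assoc _ _ _ ⟨
        K * h m ^ⁿ N * z ^ᶻ j                                                  ≈⟨ *-congʳ (expansion m) ⟩
        Σ[0… N ] (λ i → a i * q ^ᶻ (m ℤ.* + i) * g (m ℤ.* N-2i N i)) * z ^ᶻ j   ≈⟨ *-comm _ _ ⟩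
        z ^ᶻ j * Σ[0… N ] (λ i → a i * q ^ᶻ (m ℤ.* + i) * g (m ℤ.* N-2i N i))   ≈⟨ *-distribˡ-Σ N (z ^ᶻ j) _ ⟩
        Σ[0… N ] (λ i → z ^ᶻ j * (a i * q ^ᶻ (m ℤ.* + i) * g (m ℤ.* N-2i N i)))
          ≈⟨ Σ-cong N (λ i _ → solve 4 (λ y a b x → y :* (a :* b :* x) := a :* (b :* x :* y)) refl _ _ _ _) ⟩
        Σ[0… N ] (λ i → a i * (weight i j * z ^ᶻ j))                           ∎
        where m = r ℤ.* j ℤ.+ s

    module _ (K : Carrier) (h : ℤ → Carrier) (a : ℕ → Carrier)
      (expansion : ∀ m → K * h m ^ⁿ N ≈ Σ[0… N ] (λ i → a i * q ^ᶻ (m ℤ.* + i) * g (m ℤ.* N-2i N i)))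
      (k : ℤ) (z : Carrier) (k<-1⇒z≉0 : k ℤ.< -[1+ 0 ] → ¬ (z ≈ 0#)) (d≉0 : ∀ i → i ℕ.≤ N → ¬ (denominator i z ≈ 0#)) where

      generating-function-even : ε ≈ 1# →
        K * Σᶻ[0… k ] (λ j → h (r ℤ.* j ℤ.+ s) ^ⁿ N * z ^ᶻ j)
          ≈ Σ[0… N ] (λ i → a i * q ^ᶻ (s ℤ.* + i) * (upper i k z ÷ denominator i z))
            - Σ[0… N ] (λ i → a i * q ^ᶻ (s ℤ.* + i) * ((reflected i z - g (s ℤ.* N-2i N i)) ÷ denominator i z))
      generating-function-even ε≈1 = trans (generating-function K h a expansion k z k<-1⇒z≉0 d≉0)
        (+-congˡ (-‿cong (Σ-cong N (λ i _ → *-congˡ (*-congʳ (+-congʳ (trans (*-congʳ ε≈1) (*-identityˡ _))))))))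

      generating-function-odd : ε ≈ - 1# →
        K * Σᶻ[0… k ] (λ j → h (r ℤ.* j ℤ.+ s) ^ⁿ N * z ^ᶻ j)
          ≈ Σ[0… N ] (λ i → a i * q ^ᶻ (s ℤ.* + i) * (upper i k z ÷ denominator i z))
            + Σ[0… N ] (λ i → a i * q ^ᶻ (s ℤ.* + i) * ((reflected i z + g (s ℤ.* N-2i N i)) ÷ denominator i z))
      generating-function-odd ε≈-1 = trans (generating-function K h a expansion k z k<-1⇒z≉0 d≉0)
        (+-congˡ (trans (sym (Σ-neg N _)) (Σ-cong N (λ i _ → trans (-‿cong (*-congˡ (*-congʳ (+-congʳ (trans (*-congʳ ε≈-1) (-1*x≈-x _))))))
          (solve 5 (λ a b y x d → :- (a :* b :* ((:- y :- x) :* d)) := a :* b :* ((y :+ x) :* d)) refl _ _ _ _ _)))))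

open import Data.Product using (_×_; _,_)

theorem2 : ∀ {c ℓ} (F : Field c ℓ) → FieldOps.CharZero F → (p q : Field.Carrier F) →
  let open Field F hiding (zero)
      open FieldOps F
      open Lucas F p q
      D = p * p - fromℕ 4 * q
  in ¬ (p ≈ 0#) → ¬ (q ≈ 0#) → ¬ (D ≈ 0#) →
     (r s k : ℤ) (n : ℕ) (z : Carrier) →
     -- negative powers of z occur on the right iff k ≤ -2
     (k ℤ.< -[1+ 0 ] → ¬ (z ≈ 0#)) →
     -- first identity (n ≥ 0)
     ((∀ i → i ℕ.≤ 2 ℕ.* n →
         ¬ (q ^ᶻ (+ 2 ℤ.* r ℤ.* + n) * (z * z)
            - q ^ᶻ (r ℤ.* + i) * v (r ℤ.* (+ (2 ℕ.* n) ℤ.- + 2 ℤ.* + i)) * z + 1# ≈ 0#)) →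
      fromℕ 2 * D ^ⁿ n * Σᶻ[0… k ] (λ j → u (r ℤ.* j ℤ.+ s) ^ⁿ (2 ℕ.* n) * z ^ᶻ j)
      ≈ Σ[0… 2 ℕ.* n ] (λ i → sgn i * fromℕ ((2 ℕ.* n) C i) * q ^ᶻ (s ℤ.* + i) *
          ((q ^ᶻ (r ℤ.* (+ (2 ℕ.* n) ℤ.+ k ℤ.* + i)) * v ((r ℤ.* k ℤ.+ s) ℤ.* (+ (2 ℕ.* n) ℤ.- + 2 ℤ.* + i)) * z ^ᶻ (k ℤ.+ + 2)
            - q ^ᶻ (r ℤ.* + i ℤ.* (k ℤ.+ + 1)) * v ((r ℤ.* k ℤ.+ r ℤ.+ s) ℤ.* (+ (2 ℕ.* n) ℤ.- + 2 ℤ.* + i)) * z ^ᶻ (k ℤ.+ + 1))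
           ÷ (q ^ᶻ (+ 2 ℤ.* r ℤ.* + n) * (z * z)
              - q ^ᶻ (r ℤ.* + i) * v (r ℤ.* (+ (2 ℕ.* n) ℤ.- + 2 ℤ.* + i)) * z + 1#)))
        - Σ[0… 2 ℕ.* n ] (λ i → sgn i * fromℕ ((2 ℕ.* n) C i) * q ^ᶻ (s ℤ.* + i) *
          ((q ^ᶻ (s ℤ.* (+ (2 ℕ.* n) ℤ.- + 2 ℤ.* + i) ℤ.+ r ℤ.* + i) * v ((r ℤ.- s) ℤ.* (+ (2 ℕ.* n) ℤ.- + 2 ℤ.* + i)) * z
            - v (s ℤ.* (+ (2 ℕ.* n) ℤ.- + 2 ℤ.* + i)))
           ÷ (q ^ᶻ (+ 2 ℤ.* r ℤ.* + n) * (z * z)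
              - q ^ᶻ (r ℤ.* + i) * v (r ℤ.* (+ (2 ℕ.* n) ℤ.- + 2 ℤ.* + i)) * z + 1#))))
     ×
     -- second identity (n ≥ 1); here 2n - 1 is the natural number 2 * n ∸ 1
     (1 ℕ.≤ n →
      (∀ i → i ℕ.≤ 2 ℕ.* n ℕ.∸ 1 →
         ¬ (q ^ᶻ (+ (2 ℕ.* n ℕ.∸ 1) ℤ.* r) * (z * z)
            - q ^ᶻ (r ℤ.* + i) * v (r ℤ.* (+ (2 ℕ.* n ℕ.∸ 1) ℤ.- + 2 ℤ.* + i)) * z + 1# ≈ 0#)) →
      fromℕ 2 * D ^ⁿ (n ℕ.∸ 1) * Σᶻ[0… k ] (λ j → u (r ℤ.* j ℤ.+ s) ^ⁿ (2 ℕ.* n ℕ.∸ 1) * z ^ᶻ j)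
      ≈ Σ[0… 2 ℕ.* n ℕ.∸ 1 ] (λ i → sgn i * fromℕ ((2 ℕ.* n ℕ.∸ 1) C i) * q ^ᶻ (s ℤ.* + i) *
          ((q ^ᶻ (r ℤ.* (+ (2 ℕ.* n ℕ.∸ 1) ℤ.+ k ℤ.* + i)) * u ((r ℤ.* k ℤ.+ s) ℤ.* (+ (2 ℕ.* n ℕ.∸ 1) ℤ.- + 2 ℤ.* + i)) * z ^ᶻ (k ℤ.+ + 2)
            - q ^ᶻ (r ℤ.* + i ℤ.* (k ℤ.+ + 1)) * u ((r ℤ.* k ℤ.+ r ℤ.+ s) ℤ.* (+ (2 ℕ.* n ℕ.∸ 1) ℤ.- + 2 ℤ.* + i)) * z ^ᶻ (k ℤ.+ + 1))
           ÷ (q ^ᶻ (+ (2 ℕ.* n ℕ.∸ 1) ℤ.* r) * (z * z)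
              - q ^ᶻ (r ℤ.* + i) * v (r ℤ.* (+ (2 ℕ.* n ℕ.∸ 1) ℤ.- + 2 ℤ.* + i)) * z + 1#)))
        + Σ[0… 2 ℕ.* n ℕ.∸ 1 ] (λ i → sgn i * fromℕ ((2 ℕ.* n ℕ.∸ 1) C i) * q ^ᶻ (s ℤ.* + i) *
          ((q ^ᶻ (s ℤ.* (+ (2 ℕ.* n ℕ.∸ 1) ℤ.- + 2 ℤ.* + i) ℤ.+ r ℤ.* + i) * u ((r ℤ.- s) ℤ.* (+ (2 ℕ.* n ℕ.∸ 1) ℤ.- + 2 ℤ.* + i)) * z
            + u (s ℤ.* (+ (2 ℕ.* n ℕ.∸ 1) ℤ.- + 2 ℤ.* + i)))
           ÷ (q ^ᶻ (+ (2 ℕ.* n ℕ.∸ 1) ℤ.* r) * (z * z)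
              - q ^ᶻ (r ℤ.* + i) * v (r ℤ.* (+ (2 ℕ.* n ℕ.∸ 1) ℤ.- + 2 ℤ.* + i)) * z + 1#))))
     ×
     -- third identity (n ≥ 0)
     ((∀ i → i ℕ.≤ n →
         ¬ (q ^ᶻ (r ℤ.* + n) * (z * z)
            - q ^ᶻ (r ℤ.* + i) * v (r ℤ.* (+ n ℤ.- + 2 ℤ.* + i)) * z + 1# ≈ 0#)) →
      fromℕ 2 * Σᶻ[0… k ] (λ j → v (r ℤ.* j ℤ.+ s) ^ⁿ n * z ^ᶻ j)
      ≈ Σ[0… n ] (λ i → fromℕ (n C i) * q ^ᶻ (s ℤ.* + i) *
          ((q ^ᶻ (r ℤ.* (+ n ℤ.+ k ℤ.* + i)) * v ((r ℤ.* k ℤ.+ s) ℤ.* (+ n ℤ.- + 2 ℤ.* + i)) * z ^ᶻ (k ℤ.+ + 2)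
            - q ^ᶻ (r ℤ.* + i ℤ.* (k ℤ.+ + 1)) * v ((r ℤ.* k ℤ.+ r ℤ.+ s) ℤ.* (+ n ℤ.- + 2 ℤ.* + i)) * z ^ᶻ (k ℤ.+ + 1))
           ÷ (q ^ᶻ (r ℤ.* + n) * (z * z)
              - q ^ᶻ (r ℤ.* + i) * v (r ℤ.* (+ n ℤ.- + 2 ℤ.* + i)) * z + 1#)))
        - Σ[0… n ] (λ i → fromℕ (n C i) * q ^ᶻ (s ℤ.* + i) *
          ((q ^ᶻ (s ℤ.* (+ n ℤ.- + 2 ℤ.* + i) ℤ.+ r ℤ.* + i) * v ((r ℤ.- s) ℤ.* (+ n ℤ.- + 2 ℤ.* + i)) * z
            - v (s ℤ.* (+ n ℤ.- + 2 ℤ.* + i)))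
           ÷ (q ^ᶻ (r ℤ.* + n) * (z * z)
              - q ^ᶻ (r ℤ.* + i) * v (r ℤ.* (+ n ℤ.- + 2 ℤ.* + i)) * z + 1#))))

theorem2 F char0 p q _ q≉0 _ r s k n z k<-1⇒z≉0 =
    (λ d≉0 → V.generating-function-even (2 ℕ.* n) r s (+ 2 ℤ.* r ℤ.* + n) 2rn≡r[2n]
               (fromℕ 2 * D ^ⁿ n) u (λ i → sgn i * fromℕ ((2 ℕ.* n) C i)) (u-even-power-expansion n)
               k z k<-1⇒z≉0 d≉0 refl)
  , (λ 1≤n d≉0 → U.generating-function-odd (2 ℕ.* n ℕ.∸ 1) r s (+ (2 ℕ.* n ℕ.∸ 1) ℤ.* r) (ℤ.*-comm _ r)
                   (fromℕ 2 * D ^ⁿ (n ℕ.∸ 1)) u (λ i → sgn i * fromℕ ((2 ℕ.* n ℕ.∸ 1) C i)) (u-odd-power-expansion n 1≤n)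
                   k z k<-1⇒z≉0 d≉0 refl)
  , (λ d≉0 → V.generating-function-even n r s (r ℤ.* + n) ≡.refl
               (fromℕ 2) v (λ i → fromℕ (n C i)) (v-power-expansion n)
               k z k<-1⇒z≉0 d≉0 refl)
  where
  open Field F hiding (zero)
  open FieldOps F
  open Lucas F p q
  open LucasBinet F p q q≉0 (char0 1)
  open LucasGeneratingFunctions F p q q≉0
  module V = GeneratingFunction v 1# v-addition v-reflection
  module U = GeneratingFunction u (- 1#) u-addition u-reflection
  2rn≡r[2n] : + 2 ℤ.* r ℤ.* + n ≡ r ℤ.* + (2 ℕ.* n)
  2rn≡r[2n] = ≡.trans (reassociate r (+ n)) (≡.cong (r ℤ.*_) (≡.sym (ℤ.pos-* 2 n)))
    where
    reassociate : ∀ r n → + 2 ℤ.* r ℤ.* n ≡ r ℤ.* (+ 2 ℤ.* n)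
    reassociate = solve-∀
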